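{- For all integers $n\ge 1$, \[ b(n,1)=p(n,1)=2E(n-1,1). \] Moreover, there exists an explicit bijection between $B(n,1)$ and $P(n,1)$.
   Context: For a permutation $\pi=\pi_1\cdots\pi_n\in S_n$, a position $i\in\{1,\dots,n-1\}$ is an ascent if $\pi_i<\pi_{i+1}$ and a descent if $\pi_i>\pi_{i+1}$. The permutation $\pi$ is called ballot if for every $1\le k\le n-1$, the number of ascents among positions $1,\dots,k$ is at least the number of descents among positions $1,\dots,k$. Let $B(n,d)$ be the set of ballot permutations in $S_n$ with exactly $d$ descents and $b(n,d)=|B(n,d)|$. For a cycle $\mathfrak c=(c_1,\dots,c_k)$ of a permutation (fixed points are cycles of length 1), let $\mathrm{cA}(\mathfrak c)$ be the number of $i\in\{1,\dots,k\}$ with $c_i\le c_{i+1}$ and $\mathrm{cD}(\mathfrak c)$ the number with $c_i>c_{i+1}$, where $c_{k+1}=c_1$; let $M(\mathfrak c)=\min(\mathrm{cA}(\mathfrak c),\mathrm{cD}(\mathfrak c))$. For a permutation $\pi$ with cycles $\mathfrak c_1,\dots,\mathfrak c_m$, set $M(\pi)=\sum_i M(\mathfrak c_i)$. Let $P(n)$ be the set of permutations in $S_n$ of odd order (equivalently, all cycles have odd length), $P(n,d)=\{\pi\in P(n): M(\pi)=d\}$, and $p(n,d)=|P(n,d)|$. $E(n,d)$ denotes the Eulerian number: the number of permutations of $[n]$ with exactly $d$ descents, with $E(0,0)=1$ and $E(0,d)=0$ for $d\ge1$. -}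

module Defs where

open import Data.Bool using (Bool; true; false; _∧_; if_then_else_; not; T)
open import Data.Nat using (ℕ; zero; suc; _+_; _*_; _∸_; _<ᵇ_; _≤ᵇ_; _≡ᵇ_; _⊓_)
open import Data.Nat.Properties using ()
open import Data.Fin using (Fin; toℕ)
open import Data.Fin.Base using () renaming (zero to fzero; suc to fsuc)
open import Data.List using (List; []; _∷_; [_]; length; filterᵇ; map; concatMap; allFin; upTo)
open import Data.Nat.ListAction using (sum)
open import Data.Vec using (Vec; []; _∷_; lookup; toList)
open import Data.Product using (Σ)

-- Permutations of [n] in one-line notation.
-- The values 1..n are encoded by Fin n (0..n-1), which is order-isomorphic,
-- so ascents/descents/cycle statistics are unchanged.

notIn : ℕ → List ℕ → Bool
notIn x []       = true
notIn x (y ∷ ys) = not (x ≡ᵇ y) ∧ notIn x ys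

distinct : List ℕ → Bool
distinct []       = true
distinct (x ∷ xs) = notIn x xs ∧ distinct xs

values : ∀ {n} → Vec (Fin n) n → List ℕ
values v = map toℕ (toList v)

isPerm : ∀ {n} → Vec (Fin n) n → Bool
isPerm v = distinct (values v)

allWords : (n k : ℕ) → List (Vec (Fin n) k)
allWords n zero    = [ [] ]
allWords n (suc k) = concatMap (λ x → map (x ∷_) (allWords n k)) (allFin n)

count : ∀ {n} → (Vec (Fin n) n → Bool) → ℕ
count {n} P = length (filterᵇ P (allWords n n))

des : List ℕ → ℕ
des (x ∷ y ∷ rest) = (if y <ᵇ x then 1 else 0) + des (y ∷ rest)
des _              = 0

-- ballotAux a d x w (x = previous entry) : a, d = numbers of ascents / descents seen so far;
-- after each position k it checks (#ascents in 1..k) ≥ (#descents in 1..k).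
ballotAux : ℕ → ℕ → ℕ → List ℕ → Bool
ballotAux a d x []       = true
ballotAux a d x (y ∷ rest) =
  if x <ᵇ y then (d ≤ᵇ suc a) ∧ ballotAux (suc a) d y rest
            else (suc d ≤ᵇ a) ∧ ballotAux a (suc d) y rest

isBallot : List ℕ → Bool
isBallot []       = true
isBallot (x ∷ xs) = ballotAux 0 0 x xs

inB : (n d : ℕ) → Vec (Fin n) n → Bool
inB n d v = isPerm v ∧ isBallot (values v) ∧ (des (values v) ≡ᵇ d)

B : ℕ → ℕ → Set
B n d = Σ (Vec (Fin n) n) (λ v → T (inB n d v))

b : ℕ → ℕ → ℕ
b n d = count (inB n d)

E : ℕ → ℕ → ℕ
E n d = count {n} (λ v → isPerm v ∧ (des (values v) ≡ᵇ d))

allB : {A : Set} → (A → Bool) → List A → Bool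
allB f []       = true
allB f (x ∷ xs) = f x ∧ allB f xs

iter : ∀ {n} → Vec (Fin n) n → ℕ → Fin n → Fin n
iter v zero    i = i
iter v (suc k) i = lookup v (iter v k i)

_≡ᶠ_ : ∀ {n} → Fin n → Fin n → Bool
x ≡ᶠ y = toℕ x ≡ᵇ toℕ y

-- length of the cycle of π containing i: least k in 1..n with π^k(i) = i
-- (searched with fuel; for a permutation of [n] such k ≤ n always exists).
cycLenFrom : ∀ {n} → Vec (Fin n) n → Fin n → ℕ → ℕ → ℕ
cycLenFrom v i k zero       = k
cycLenFrom v i k (suc fuel) = if iter v k i ≡ᶠ i then k else cycLenFrom v i (suc k) fuel

cycLen : ∀ {n} → Vec (Fin n) n → Fin n → ℕ
cycLen {n} v i = cycLenFrom v i 1 n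

-- The cycle of i is (c_1,...,c_L) = (i, π i, ..., π^{L-1} i), and c_{L+1} = π^L i = i.
-- cA: number of j with c_j ≤ c_{j+1};  cD: number with c_j > c_{j+1}.
cA : ∀ {n} → Vec (Fin n) n → Fin n → ℕ
cA v i = length (filterᵇ (λ j → toℕ (iter v j i) ≤ᵇ toℕ (iter v (suc j) i)) (upTo (cycLen v i)))

cD : ∀ {n} → Vec (Fin n) n → Fin n → ℕ
cD v i = length (filterᵇ (λ j → toℕ (iter v (suc j) i) <ᵇ toℕ (iter v j i)) (upTo (cycLen v i)))

-- i is the chosen representative of its cycle iff it is the minimum of its cycle.
isCycleMin : ∀ {n} → Vec (Fin n) n → Fin n → Bool
isCycleMin v i = allB (λ j → toℕ i ≤ᵇ toℕ (iter v j i)) (upTo (cycLen v i))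

-- M(π) = Σ over cycles of min(cA, cD)  (each cycle counted once, via its minimum).
Mstat : ∀ {n} → Vec (Fin n) n → ℕ
Mstat {n} v = sum (map (λ i → if isCycleMin v i then cA v i ⊓ cD v i else 0) (allFin n))

odd : ℕ → Bool
odd zero          = false
odd (suc zero)    = true
odd (suc (suc k)) = odd k

-- odd order  ⇔  all cycles have odd length
oddOrder : ∀ {n} → Vec (Fin n) n → Bool
oddOrder {n} v = allB (λ i → odd (cycLen v i)) (allFin n)

inP : (n d : ℕ) → Vec (Fin n) n → Bool
inP n d v = isPerm v ∧ oddOrder v ∧ (Mstat v ≡ᵇ d)

P : ℕ → ℕ → Set
P n d = Σ (Vec (Fin n) n) (λ v → T (inP n d v))

p : ℕ → ℕ → ℕ
p n d = count (inP n d)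

-- A permutation with exactly one descent is the concatenation of two increasing runs, so it is
-- determined by the set of values of its first run; these sets are exactly the subsets of [n]
-- that are not initial segments, and the permutation is ballot iff its first run is not a single
-- entry. Hence b(n,1) = 2^n - 2n and E(n-1,1) = 2^(n-1) - n.
-- The summand min(cA, cD) of a cycle vanishes only on fixed points, so M = 1 forces a single
-- non-trivial cycle; odd order makes its length odd, hence at least 3, and it has one descent or
-- one ascent. Read from its minimum such a cycle is increasing, or has its only ascent at the
-- first step; it is thus determined by its support, an odd subset of size at least 3, and by a
-- choice between the two shapes, so p(n,1) = 2 (2^(n-1) - n). Equal counts give B(n,1) ↔ P(n,1).

module Submission where

open import Defs
import Data.Nat
import Data.Nat.Properties
open import Algebra.Properties.CommutativeSemigroup Data.Nat.Properties.+-commutativeSemigroup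
  using () renaming (interchange to +-interchange)
open import Data.Bool using (Bool; true; false; T; T?; not; _∧_; _∨_; if_then_else_)
open import Data.Bool.Properties using (T-irrelevant)
open import Data.Empty using (⊥-elim)
open import Data.Fin using (Fin; toℕ; fromℕ<; punchOut) renaming (zero to fzero; suc to fsuc)
import Data.Fin as Fin
open import Data.Fin.Permutation using (↔⇒≡)
open import Data.Fin.Properties using (+↔⊎; toℕ-injective; toℕ<n; toℕ-fromℕ<; pigeonhole; punchOut-injective; any?)
import Data.Fin.Properties as Finₚ
open import Data.Fin.Subset using (Subset; ∣_∣)
open import Data.List
  using (List; []; _∷_; [_]; _++_; _∷ʳ_; length; reverse; map; filterᵇ; concatMap; tabulate; allFin; applyUpTo;
         initLast; _∷ʳ′_)
open import Data.List.Membership.DecPropositional Data.Nat._≟_ using (_∈?_)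
open import Data.List.Membership.Propositional using (_∈_; _∉_)
open import Data.List.Membership.Propositional.Properties
  using (∈-++⁺ˡ; ∈-++⁺ʳ; ∈-++⁻; ∈-filter⁺; ∈-filter⁻; ∈-allFin; ∈-map⁺; ∈-map⁻; ∈-applyUpTo⁺; ∈-applyUpTo⁻)
open import Data.List.Properties
  using (length-++; ++-assoc; filter-++; map-++; length-map; map-tabulate; length-tabulate; map-injective;
         length-reverse; unfold-reverse; reverse-involutive; length-applyUpTo)
import Data.List.Properties as Listₚ
open import Data.List.Relation.Unary.All using (All; []; _∷_)
import Data.List.Relation.Unary.All as All
import Data.List.Relation.Unary.All.Properties as Allₚ
open import Data.List.Relation.Unary.AllPairs using (AllPairs; []; _∷_)
import Data.List.Relation.Unary.AllPairs as AllPairs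
import Data.List.Relation.Unary.AllPairs.Properties as AllPairsₚ
open import Data.List.Relation.Unary.Any using (here; there)
import Data.List.Relation.Unary.Any as Any
import Data.List.Relation.Unary.Any.Properties as Anyₚ
open import Data.List.Relation.Unary.Linked using (Linked; []; [-]; _∷_)
open import Data.List.Relation.Unary.Linked.Properties using (Linked⇒AllPairs; AllPairs⇒Linked)
open import Data.List.Relation.Unary.Unique.Propositional using (Unique)
import Data.List.Relation.Unary.Unique.Propositional.Properties as Uniqueₚ
open import Data.Nat
  using (ℕ; zero; suc; _+_; _*_; _^_; _∸_; _<_; _≤_; _⊓_; _<ᵇ_; _≤ᵇ_; _≡ᵇ_; z≤n; s≤s; s≤s⁻¹; NonZero; >-nonZero; _%_; _/_)
open import Data.Nat.DivMod using (m≡m%n+[m/n]*n; m%n<n)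
open import Data.Nat.ListAction using (sum)
open import Data.Nat.Properties
  using (+-assoc; +-cancelʳ-≡; +-cancelˡ-≡; +-cancelˡ-≤; +-comm; +-identityʳ; +-monoˡ-≤; +-suc; 0≢1+n;
         <-asym; <-cmp; <-irrefl; <-trans; <-≤-trans; <ᵇ⇒<; <⇒<ᵇ; <⇒≢; <⇒≤; <⇒≱; m+[n∸m]≡n; m+n≡0⇒m≡0;
         m+n≡0⇒n≡0; m<n⇒0<n∸m; m∸n+n≡m; m∸n≤m; m≤n⇒m<n∨m≡n; m≤n⇒m≤1+n; m≤n⇒m⊓n≡m; m≥n⇒m⊓n≡n; n<1+n;
         suc-injective; ≡ᵇ⇒≡; ≡⇒≡ᵇ; ≤-<-trans; ≤-antisym; ≤-refl; ≤-reflexive; ≤-total; ≤-trans; ≤ᵇ⇒≤; ≤⇒≤ᵇ;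
         ≤∧≢⇒<; ≮⇒≥; ⊓-zeroʳ; ⊓-sel; _≟_; module ≤-Reasoning)
open import Data.Nat.Tactic.RingSolver using (solve-∀)
open import Data.Product using (Σ; ∃; _,_; _×_; proj₁; proj₂)
open import Data.Product.Function.Dependent.Propositional using (Σ-↔)
open import Data.Sum using (_⊎_; inj₁; inj₂)
open import Data.Sum.Function.Propositional using (_⊎-↔_)
open import Data.Unit using (tt)
open import Data.Vec using (Vec; []; _∷_; lookup; toList; fromList; cast)
import Data.Vec as V
open import Data.Vec.Properties
  using (cast-is-id; toList-cast; toList∘fromList; toList-injective; lookup∘tabulate; tabulate∘lookup; tabulate-cong)
open import Function using (_∘_; id; flip)
open import Function.Bundles using (_↔_; mk↔ₛ′)
open import Function.Properties.Inverse using (↔-sym; ↔-refl)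
import Function.Related.Propositional as Related
open import Relation.Binary using (tri<; tri≈; tri>)
open import Relation.Binary.Definitions using (Irreflexive; Asymmetric)
open import Relation.Binary.PropositionalEquality
  using (_≡_; _≢_; refl; sym; trans; cong; cong₂; subst; module ≡-Reasoning)
open import Relation.Nullary using (Dec; yes; no; does)
open import Relation.Nullary.Decidable using (dec-true; dec-false)

∧-trueˡ : ∀ {a b} → a ∧ b ≡ true → a ≡ true
∧-trueˡ {true} _ = refl

∧-trueʳ : ∀ {a b} → a ∧ b ≡ true → b ≡ true
∧-trueʳ {true} e = e

∧-true : ∀ {a b} → a ≡ true → b ≡ true → a ∧ b ≡ true
∧-true refl refl = refl

not-true : ∀ {a} → not a ≡ true → a ≡ false
not-true {false} _ = refl

T⇒≡true : ∀ {a} → T a → a ≡ true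
T⇒≡true {true} _ = refl

≡true⇒T : ∀ {a} → a ≡ true → T a
≡true⇒T refl = tt

true≢false : true ≢ false
true≢false ()

≡ᵇ-true⁻ : ∀ {m n} → (m ≡ᵇ n) ≡ true → m ≡ n
≡ᵇ-true⁻ {m} {n} e = ≡ᵇ⇒≡ m n (≡true⇒T e)

≡ᵇ-true⁺ : ∀ {m n} → m ≡ n → (m ≡ᵇ n) ≡ true
≡ᵇ-true⁺ {m} {n} e = T⇒≡true (≡⇒≡ᵇ m n e)

≡ᵇ-false⁺ : ∀ {m n} → m ≢ n → (m ≡ᵇ n) ≡ false
≡ᵇ-false⁺ {m} {n} m≢n with m ≡ᵇ n in eq
... | true  = ⊥-elim (m≢n (≡ᵇ-true⁻ eq))
... | false = refl

≡ᵇ-false⁻ : ∀ {m n} → (m ≡ᵇ n) ≡ false → m ≢ n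
≡ᵇ-false⁻ e m≡n = true≢false (trans (sym (≡ᵇ-true⁺ m≡n)) e)

<ᵇ-true⁺ : ∀ {m n} → m < n → (m <ᵇ n) ≡ true
<ᵇ-true⁺ m<n = T⇒≡true (<⇒<ᵇ m<n)

<ᵇ-true⁻ : ∀ {m n} → (m <ᵇ n) ≡ true → m < n
<ᵇ-true⁻ {m} {n} e = <ᵇ⇒< m n (≡true⇒T e)

<ᵇ-false⁻ : ∀ {m n} → (m <ᵇ n) ≡ false → n ≤ m
<ᵇ-false⁻ {m} {n} e = ≮⇒≥ (λ m<n → true≢false (trans (sym (<ᵇ-true⁺ m<n)) e))

<ᵇ-false⁺ : ∀ {m n} → n ≤ m → (m <ᵇ n) ≡ false
<ᵇ-false⁺ {m} {n} n≤m with m <ᵇ n in eq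
... | true  = ⊥-elim (<⇒≱ (<ᵇ-true⁻ eq) n≤m)
... | false = refl

≤ᵇ-true⁺ : ∀ {m n} → m ≤ n → (m ≤ᵇ n) ≡ true
≤ᵇ-true⁺ m≤n = T⇒≡true (≤⇒≤ᵇ m≤n)

≤ᵇ-true⁻ : ∀ {m n} → (m ≤ᵇ n) ≡ true → m ≤ n
≤ᵇ-true⁻ {m} {n} e = ≤ᵇ⇒≤ m n (≡true⇒T e)

≤ᵇ-false⁺ : ∀ {m n} → n < m → (m ≤ᵇ n) ≡ false
≤ᵇ-false⁺ {zero}  ()
≤ᵇ-false⁺ {suc m} (s≤s n≤m) = <ᵇ-false⁺ n≤m

≤ᵇ-false⁻ : ∀ {m n} → (m ≤ᵇ n) ≡ false → n < m
≤ᵇ-false⁻ {zero}  ()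
≤ᵇ-false⁻ {suc m} e = s≤s (<ᵇ-false⁻ e)

<ᵇ≡not-≤ᵇ : ∀ m n → (n <ᵇ m) ≡ not (m ≤ᵇ n)
<ᵇ≡not-≤ᵇ m n with n <ᵇ m in eq
... | true  = sym (cong not (≤ᵇ-false⁺ {m} {n} (<ᵇ-true⁻ eq)))
... | false = sym (cong not (≤ᵇ-true⁺ {m} {n} (<ᵇ-false⁻ eq)))

subset-≡ : ∀ {A : Set} {P : A → Bool} {a a′ : A} → a ≡ a′ →
           (p : T (P a)) (p′ : T (P a′)) → _≡_ {A = Σ A (T ∘ P)} (a , p) (a′ , p′)
subset-≡ refl p p′ = cong (_ ,_) (T-irrelevant p p′)

Σ-Fin-suc : ∀ {m} (F : Fin (suc m) → Set) → Σ (Fin (suc m)) F ↔ (F fzero ⊎ Σ (Fin m) (F ∘ fsuc))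
Σ-Fin-suc F = mk↔ₛ′
  (λ { (fzero , x) → inj₁ x ; (fsuc i , x) → inj₂ (i , x) })
  (λ { (inj₁ x) → fzero , x ; (inj₂ (i , x)) → fsuc i , x })
  (λ { (inj₁ _) → refl ; (inj₂ _) → refl })
  (λ { (fzero , _) → refl ; (fsuc _ , _) → refl })

Σ-Fin-sum : ∀ m (f : Fin m → ℕ) → Σ (Fin m) (Fin ∘ f) ↔ Fin (sum (tabulate f))
Σ-Fin-sum zero f = mk↔ₛ′ (λ ()) (λ ()) (λ ()) (λ ())
Σ-Fin-sum (suc m) f = begin
  Σ (Fin (suc m)) (Fin ∘ f)                 ↔⟨ Σ-Fin-suc (Fin ∘ f) ⟩
  (Fin (f fzero) ⊎ Σ (Fin m) (Fin ∘ f ∘ fsuc)) ↔⟨ ↔-refl ⊎-↔ Σ-Fin-sum m (f ∘ fsuc) ⟩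
  (Fin (f fzero) ⊎ Fin (sum (tabulate (f ∘ fsuc)))) ↔⟨ ↔-sym +↔⊎ ⟩
  Fin (sum (tabulate f))                      ∎
  where open Related.EquationalReasoning

length-filterᵇ-map : ∀ {A B : Set} (Q : B → Bool) (f : A → B) xs →
  length (filterᵇ Q (map f xs)) ≡ length (filterᵇ (Q ∘ f) xs)
length-filterᵇ-map Q f [] = refl
length-filterᵇ-map Q f (x ∷ xs) with Q (f x)
... | true  = cong suc (length-filterᵇ-map Q f xs)
... | false = length-filterᵇ-map Q f xs

length-filterᵇ-concatMap : ∀ {A B : Set} (Q : B → Bool) (G : A → List B) xs →
  length (filterᵇ Q (concatMap G xs)) ≡ sum (map (length ∘ filterᵇ Q ∘ G) xs)
length-filterᵇ-concatMap Q G [] = refl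
length-filterᵇ-concatMap Q G (x ∷ xs) = begin
  length (filterᵇ Q (G x ++ concatMap G xs))
    ≡⟨ cong length (filter-++ _ (G x) (concatMap G xs)) ⟩
  length (filterᵇ Q (G x) ++ filterᵇ Q (concatMap G xs))
    ≡⟨ length-++ (filterᵇ Q (G x)) ⟩
  length (filterᵇ Q (G x)) + length (filterᵇ Q (concatMap G xs))
    ≡⟨ cong (length (filterᵇ Q (G x)) +_) (length-filterᵇ-concatMap Q G xs) ⟩
  length (filterᵇ Q (G x)) + sum (map (length ∘ filterᵇ Q ∘ G) xs) ∎
  where open ≡-Reasoning

countWords : ∀ n k → (Vec (Fin n) k → Bool) → ℕ
countWords n k Q = length (filterᵇ Q (allWords n k))

countWords-suc : ∀ n k (Q : Vec (Fin n) (suc k) → Bool) →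
  countWords n (suc k) Q ≡ sum (tabulate (λ x → countWords n k (Q ∘ (x ∷_))))
countWords-suc n k Q = begin
  length (filterᵇ Q (concatMap (λ x → map (x ∷_) (allWords n k)) (allFin n)))
    ≡⟨ length-filterᵇ-concatMap Q _ (allFin n) ⟩
  sum (map (λ x → length (filterᵇ Q (map (x ∷_) (allWords n k)))) (allFin n))
    ≡⟨ cong sum (map-tabulate {n = n} id _) ⟩
  sum (tabulate (λ x → length (filterᵇ Q (map (x ∷_) (allWords n k)))))
    ≡⟨ cong sum (Listₚ.tabulate-cong (λ x → length-filterᵇ-map Q (x ∷_) (allWords n k))) ⟩
  sum (tabulate (λ x → countWords n k (Q ∘ (x ∷_)))) ∎
  where open ≡-Reasoning

Σ-Vec-suc : ∀ {A : Set} {k} (F : Vec A (suc k) → Set) →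
  Σ (Vec A (suc k)) F ↔ Σ A (λ x → Σ (Vec A k) (F ∘ (x ∷_)))
Σ-Vec-suc F = mk↔ₛ′ (λ { (x ∷ xs , p) → x , xs , p }) (λ { (x , xs , p) → x ∷ xs , p })
  (λ _ → refl) (λ { (_ ∷ _ , _) → refl })

Σ-Vec-zero : ∀ {A : Set} (Q : Vec A 0 → Bool) → Σ (Vec A 0) (T ∘ Q) ↔ Fin (if Q [] then 1 else 0)
Σ-Vec-zero Q with Q [] in eq
... | true  = mk↔ₛ′ (λ _ → fzero) (λ _ → [] , ≡true⇒T eq) (λ { fzero → refl ; (fsuc ()) })
                    (λ { ([] , p) → subset-≡ {P = Q} refl _ p })
... | false = mk↔ₛ′ (λ { ([] , p) → ⊥-elim (subst T eq p) }) (λ ()) (λ ())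
                    (λ { ([] , p) → ⊥-elim (subst T eq p) })

countWords-zero : ∀ n (Q : Vec (Fin n) 0 → Bool) → countWords n 0 Q ≡ (if Q [] then 1 else 0)
countWords-zero n Q with Q []
... | true  = refl
... | false = refl

countWords-↔ : ∀ n k (Q : Vec (Fin n) k → Bool) → Σ (Vec (Fin n) k) (T ∘ Q) ↔ Fin (countWords n k Q)
countWords-↔ n zero Q = subst (λ c → Σ (Vec (Fin n) 0) (T ∘ Q) ↔ Fin c) (sym (countWords-zero n Q)) (Σ-Vec-zero Q)
countWords-↔ n (suc k) Q = begin
  Σ (Vec (Fin n) (suc k)) (T ∘ Q)                                 ↔⟨ Σ-Vec-suc (T ∘ Q) ⟩
  Σ (Fin n) (λ x → Σ (Vec (Fin n) k) (T ∘ Q ∘ (x ∷_)))           ↔⟨ Σ-↔ ↔-refl (countWords-↔ n k (Q ∘ (_ ∷_))) ⟩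
  Σ (Fin n) (λ x → Fin (countWords n k (Q ∘ (x ∷_))))            ↔⟨ Σ-Fin-sum n _ ⟩
  Fin (sum (tabulate (λ x → countWords n k (Q ∘ (x ∷_)))))        ≡⟨ cong Fin (sym (countWords-suc n k Q)) ⟩
  Fin (countWords n (suc k) Q)                                    ∎
  where open Related.EquationalReasoning

count-↔ : ∀ {n} (Q : Vec (Fin n) n → Bool) → Σ (Vec (Fin n) n) (T ∘ Q) ↔ Fin (count Q)
count-↔ {n} = countWords-↔ n n

Σ-Bool : ∀ {F : Bool → Set} → Σ Bool F ↔ (F true ⊎ F false)
Σ-Bool = mk↔ₛ′ (λ { (true , x) → inj₁ x ; (false , x) → inj₂ x })
               (λ { (inj₁ x) → true , x ; (inj₂ x) → false , x })
               (λ { (inj₁ _) → refl ; (inj₂ _) → refl })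
               (λ { (true , _) → refl ; (false , _) → refl })

countSubsets : ∀ n → (Subset n → Bool) → ℕ
countSubsets zero    P = if P [] then 1 else 0
countSubsets (suc n) P = countSubsets n (P ∘ (true ∷_)) + countSubsets n (P ∘ (false ∷_))

countSubsets-↔ : ∀ n (P : Subset n → Bool) → Σ (Subset n) (T ∘ P) ↔ Fin (countSubsets n P)
countSubsets-↔ zero P = Σ-Vec-zero P
countSubsets-↔ (suc n) P = begin
  Σ (Subset (suc n)) (T ∘ P)                                                ↔⟨ Σ-Vec-suc (T ∘ P) ⟩
  Σ Bool (λ b → Σ (Subset n) (T ∘ P ∘ (b ∷_)))                             ↔⟨ Σ-Bool ⟩
  (Σ (Subset n) (T ∘ P ∘ (true ∷_)) ⊎ Σ (Subset n) (T ∘ P ∘ (false ∷_)))   ↔⟨ countSubsets-↔ n _ ⊎-↔ countSubsets-↔ n _ ⟩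
  (Fin (countSubsets n (P ∘ (true ∷_))) ⊎ Fin (countSubsets n (P ∘ (false ∷_)))) ↔⟨ ↔-sym +↔⊎ ⟩
  Fin (countSubsets (suc n) P)                                              ∎
  where open Related.EquationalReasoning

countSubsets-cong : ∀ n {P Q : Subset n → Bool} → (∀ s → P s ≡ Q s) → countSubsets n P ≡ countSubsets n Q
countSubsets-cong zero    P≗Q = cong (if_then 1 else 0) (P≗Q [])
countSubsets-cong (suc n) P≗Q =
  cong₂ _+_ (countSubsets-cong n (P≗Q ∘ (true ∷_))) (countSubsets-cong n (P≗Q ∘ (false ∷_)))

countSubsets-const-false : ∀ n → countSubsets n (λ _ → false) ≡ 0
countSubsets-const-false zero    = refl
countSubsets-const-false (suc n) = cong₂ _+_ (countSubsets-const-false n) (countSubsets-const-false n)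

countSubsets-complement : ∀ n (P : Subset n → Bool) → countSubsets n P + countSubsets n (not ∘ P) ≡ 2 ^ n
countSubsets-complement zero P with P []
... | true  = refl
... | false = refl
countSubsets-complement (suc n) P = begin
  (x₁ + x₂) + (y₁ + y₂) ≡⟨ +-interchange x₁ x₂ y₁ y₂ ⟩
  (x₁ + y₁) + (x₂ + y₂) ≡⟨ cong₂ _+_ (countSubsets-complement n _) (countSubsets-complement n _) ⟩
  2 ^ n + 2 ^ n         ≡⟨ cong (2 ^ n +_) (sym (+-identityʳ (2 ^ n))) ⟩
  2 ^ suc n             ∎
  where
  open ≡-Reasoning
  x₁ = countSubsets n (P ∘ (true ∷_))
  x₂ = countSubsets n (P ∘ (false ∷_))
  y₁ = countSubsets n (not ∘ P ∘ (true ∷_))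
  y₂ = countSubsets n (not ∘ P ∘ (false ∷_))

countSubsets-∧-split : ∀ n (P R : Subset n → Bool) →
  countSubsets n (λ s → P s ∧ not (R s)) + countSubsets n (λ s → P s ∧ R s) ≡ countSubsets n P
countSubsets-∧-split zero P R with P [] | R []
... | true  | true  = refl
... | true  | false = refl
... | false | _     = refl
countSubsets-∧-split (suc n) P R =
  trans (+-interchange x₁ x₂ y₁ y₂)
        (cong₂ _+_ (countSubsets-∧-split n _ _) (countSubsets-∧-split n _ _))
  where
  x₁ = countSubsets n (λ s → P (true ∷ s) ∧ not (R (true ∷ s)))
  x₂ = countSubsets n (λ s → P (false ∷ s) ∧ not (R (false ∷ s)))
  y₁ = countSubsets n (λ s → P (true ∷ s) ∧ R (true ∷ s))
  y₂ = countSubsets n (λ s → P (false ∷ s) ∧ R (false ∷ s))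

isInitial : ∀ {n} → Subset n → Bool
isInitial []          = true
isInitial (true ∷ s)  = isInitial s
isInitial (false ∷ s) = ∣ s ∣ ≡ᵇ 0

isNonInitial : ∀ {n} → Subset n → Bool
isNonInitial s = not (isInitial s)

isBallotRun : ∀ {n} → Subset n → Bool
isBallotRun s = not (isInitial s ∨ (∣ s ∣ ≡ᵇ 1))

isOddCycleSupport : ∀ {n} → Subset n → Bool
isOddCycleSupport s = odd ∣ s ∣ ∧ not (∣ s ∣ ≡ᵇ 1)

countSubsets-size≡0 : ∀ n → countSubsets n (λ s → ∣ s ∣ ≡ᵇ 0) ≡ 1
countSubsets-size≡0 zero    = refl
countSubsets-size≡0 (suc n) = cong₂ _+_ (countSubsets-const-false n) (countSubsets-size≡0 n)

countSubsets-size≡1 : ∀ n → countSubsets n (λ s → ∣ s ∣ ≡ᵇ 1) ≡ n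
countSubsets-size≡1 zero    = refl
countSubsets-size≡1 (suc n) = cong₂ _+_ (countSubsets-size≡0 n) (countSubsets-size≡1 n)

countSubsets-size≤1 : ∀ n → countSubsets n (λ s → (∣ s ∣ ≡ᵇ 0) ∨ (∣ s ∣ ≡ᵇ 1)) ≡ suc n
countSubsets-size≤1 zero    = refl
countSubsets-size≤1 (suc n) = cong₂ _+_ (countSubsets-size≡0 n) (countSubsets-size≤1 n)

countSubsets-isInitial : ∀ n → countSubsets n isInitial ≡ suc n
countSubsets-isInitial zero    = refl
countSubsets-isInitial (suc n) =
  trans (cong₂ _+_ (countSubsets-isInitial n) (countSubsets-size≡0 n)) (+-comm (suc n) 1)

isInitial-∨-empty : ∀ {n} (s : Subset n) → (isInitial s ∨ (∣ s ∣ ≡ᵇ 0)) ≡ isInitial s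
isInitial-∨-empty []          = refl
isInitial-∨-empty (true ∷ s)  with isInitial s
... | true  = refl
... | false = refl
isInitial-∨-empty (false ∷ s) with ∣ s ∣ ≡ᵇ 0
... | true  = refl
... | false = refl

odd-suc : ∀ k → odd (suc k) ≡ not (odd k)
odd-suc zero          = refl
odd-suc (suc zero)    = refl
odd-suc (suc (suc k)) = odd-suc k

odd-∧-≡ᵇ1 : ∀ k → (odd k ∧ (k ≡ᵇ 1)) ≡ (k ≡ᵇ 1)
odd-∧-≡ᵇ1 zero          = refl
odd-∧-≡ᵇ1 (suc zero)    = refl
odd-∧-≡ᵇ1 (suc (suc k)) with odd k
... | true  = refl
... | false = refl

countSubsets-oddSize : ∀ m → countSubsets (suc m) (odd ∘ ∣_∣) ≡ 2 ^ m
countSubsets-oddSize m = begin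
  countSubsets m (λ s → odd (suc ∣ s ∣)) + countSubsets m (odd ∘ ∣_∣)
    ≡⟨ cong (_+ countSubsets m (odd ∘ ∣_∣)) (countSubsets-cong m (odd-suc ∘ ∣_∣)) ⟩
  countSubsets m (not ∘ odd ∘ ∣_∣) + countSubsets m (odd ∘ ∣_∣)
    ≡⟨ +-comm _ (countSubsets m (odd ∘ ∣_∣)) ⟩
  countSubsets m (odd ∘ ∣_∣) + countSubsets m (not ∘ odd ∘ ∣_∣)
    ≡⟨ countSubsets-complement m (odd ∘ ∣_∣) ⟩
  2 ^ m ∎
  where open ≡-Reasoning

countSubsets-isNonInitial : ∀ m → countSubsets m isNonInitial + suc m ≡ 2 ^ m
countSubsets-isNonInitial m = begin
  countSubsets m isNonInitial + suc m                    ≡⟨ +-comm _ (suc m) ⟩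
  suc m + countSubsets m isNonInitial                    ≡⟨ cong (_+ countSubsets m isNonInitial) (sym (countSubsets-isInitial m)) ⟩
  countSubsets m isInitial + countSubsets m isNonInitial ≡⟨ countSubsets-complement m isInitial ⟩
  2 ^ m                                                  ∎
  where open ≡-Reasoning

countSubsets-isBallotRun : ∀ m → countSubsets (suc m) isBallotRun + (suc m + suc m) ≡ 2 ^ suc m
countSubsets-isBallotRun m = begin
  countSubsets (suc m) isBallotRun + (suc m + suc m)
    ≡⟨ +-comm _ (suc m + suc m) ⟩
  (suc m + suc m) + countSubsets (suc m) isBallotRun
    ≡⟨ cong (_+ countSubsets (suc m) isBallotRun) (sym countExcluded) ⟩
  countSubsets (suc m) excluded + countSubsets (suc m) (not ∘ excluded)
    ≡⟨ countSubsets-complement (suc m) excluded ⟩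
  2 ^ suc m ∎
  where
  open ≡-Reasoning
  excluded : Subset (suc m) → Bool
  excluded s = isInitial s ∨ (∣ s ∣ ≡ᵇ 1)
  countExcluded : countSubsets (suc m) excluded ≡ suc m + suc m
  countExcluded = cong₂ _+_
    (trans (countSubsets-cong m isInitial-∨-empty) (countSubsets-isInitial m))
    (countSubsets-size≤1 m)

countSubsets-isOddCycleSupport : ∀ m → countSubsets (suc m) isOddCycleSupport + suc m ≡ 2 ^ m
countSubsets-isOddCycleSupport m = begin
  countSubsets (suc m) isOddCycleSupport + suc m
    ≡⟨ cong (countSubsets (suc m) isOddCycleSupport +_) (sym countSingletons) ⟩
  countSubsets (suc m) isOddCycleSupport + countSubsets (suc m) (λ s → odd ∣ s ∣ ∧ (∣ s ∣ ≡ᵇ 1))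
    ≡⟨ countSubsets-∧-split (suc m) (odd ∘ ∣_∣) (λ s → ∣ s ∣ ≡ᵇ 1) ⟩
  countSubsets (suc m) (odd ∘ ∣_∣)
    ≡⟨ countSubsets-oddSize m ⟩
  2 ^ m ∎
  where
  open ≡-Reasoning
  countSingletons : countSubsets (suc m) (λ s → odd ∣ s ∣ ∧ (∣ s ∣ ≡ᵇ 1)) ≡ suc m
  countSingletons = trans (countSubsets-cong (suc m) (odd-∧-≡ᵇ1 ∘ ∣_∣)) (countSubsets-size≡1 (suc m))

-- Permutations with one descent

Increasing : List ℕ → Set
Increasing = Linked _<_

record TwoRuns (L : List ℕ) : Set where
  constructor twoRuns
  field
    front  : List ℕ
    peak   : ℕ
    valley : ℕ
    back   : List ℕ
    shape  : L ≡ front ++ peak ∷ valley ∷ back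
    firstIncreasing  : Increasing (front ∷ʳ peak)
    secondIncreasing : Increasing (valley ∷ back)
    valley<peak      : valley < peak

  firstRun secondRun : List ℕ
  firstRun  = front ∷ʳ peak
  secondRun = valley ∷ back

  shape-runs : L ≡ firstRun ++ secondRun
  shape-runs = trans shape (sym (++-assoc front [ peak ] secondRun))

des-increasing : ∀ {xs} → Increasing xs → des xs ≡ 0
des-increasing []      = refl
des-increasing [-]     = refl
des-increasing (x<y ∷ inc) rewrite <ᵇ-false⁺ (<⇒≤ x<y) = des-increasing inc

des-ascent : ∀ {x y} r → x < y → des (x ∷ y ∷ r) ≡ des (y ∷ r)
des-ascent r x<y rewrite <ᵇ-false⁺ (<⇒≤ x<y) = refl

des-twoRuns : ∀ {L} → TwoRuns L → des L ≡ 1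
des-twoRuns (twoRuns front a b B refl inc₁ inc₂ b<a) = go front inc₁
  where
  go : ∀ A → Increasing (A ∷ʳ a) → des (A ++ a ∷ b ∷ B) ≡ 1
  go []          _           rewrite <ᵇ-true⁺ b<a = cong suc (des-increasing inc₂)
  go (x ∷ [])    (x<a ∷ inc) = trans (des-ascent (b ∷ B) x<a) (go [] inc)
  go (x ∷ y ∷ A) (x<y ∷ inc) = trans (des-ascent (A ++ a ∷ b ∷ B) x<y) (go (y ∷ A) inc)

des≡0⇒increasing : ∀ {L} → Unique L → des L ≡ 0 → Increasing L
des≡0⇒increasing {[]}        _                 _ = []
des≡0⇒increasing {x ∷ []}    _                 _ = [-]
des≡0⇒increasing {x ∷ y ∷ r} ((x≢y ∷ _) ∷ u) e with y <ᵇ x in eq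
... | false = ≤∧≢⇒< (<ᵇ-false⁻ eq) x≢y ∷ des≡0⇒increasing u e

twoRuns-∷ : ∀ {x y r} → x < y → TwoRuns (y ∷ r) → TwoRuns (x ∷ y ∷ r)
twoRuns-∷ {x} x<y (twoRuns A a b B shape inc₁ inc₂ b<a) =
  twoRuns (x ∷ A) a b B (cong (x ∷_) shape) (prepend A shape inc₁) inc₂ b<a
  where
  prepend : ∀ A → _ ≡ A ++ a ∷ b ∷ B → Increasing (A ∷ʳ a) → Increasing (x ∷ A ∷ʳ a)
  prepend []      refl inc = x<y ∷ inc
  prepend (_ ∷ _) refl inc = x<y ∷ inc

des≡1⇒twoRuns : ∀ {L} → Unique L → des L ≡ 1 → TwoRuns L
des≡1⇒twoRuns {x ∷ y ∷ r} ((x≢y ∷ _) ∷ u) e with y <ᵇ x in eq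
... | true  = twoRuns [] x y r refl [-] (des≡0⇒increasing u (suc-injective e)) (<ᵇ-true⁻ eq)
... | false = twoRuns-∷ (≤∧≢⇒< (<ᵇ-false⁻ eq) x≢y) (des≡1⇒twoRuns u e)

leadingRun : List ℕ → List ℕ
leadingRun []          = []
leadingRun (x ∷ [])    = [ x ]
leadingRun (x ∷ y ∷ r) = if y <ᵇ x then [ x ] else x ∷ leadingRun (y ∷ r)

leadingRun-twoRuns : ∀ {L} (sp : TwoRuns L) → leadingRun L ≡ TwoRuns.firstRun sp
leadingRun-twoRuns (twoRuns front a b B refl inc₁ _ b<a) = go front inc₁
  where
  go : ∀ A → Increasing (A ∷ʳ a) → leadingRun (A ++ a ∷ b ∷ B) ≡ A ∷ʳ a
  go []          _          rewrite <ᵇ-true⁺ b<a = refl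
  go (x ∷ [])    (x<a ∷ inc) rewrite <ᵇ-false⁺ (<⇒≤ x<a) = cong (x ∷_) (go [] inc)
  go (x ∷ y ∷ A) (x<y ∷ inc) rewrite <ᵇ-false⁺ (<⇒≤ x<y) = cong (x ∷_) (go (y ∷ A) inc)

ballotAux-increasing : ∀ k d x L → d ≤ k → Increasing (x ∷ L) → ballotAux k d x L ≡ true
ballotAux-increasing k d x []      d≤k _ = refl
ballotAux-increasing k d x (y ∷ L) d≤k (x<y ∷ inc)
  rewrite <ᵇ-true⁺ x<y | ≤ᵇ-true⁺ (m≤n⇒m≤1+n d≤k) =
  ballotAux-increasing (suc k) d y L (m≤n⇒m≤1+n d≤k) inc

isBallot-twoRuns : ∀ {L} (sp : TwoRuns L) → isBallot L ≡ not (length (TwoRuns.firstRun sp) ≡ᵇ 1)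
isBallot-twoRuns (twoRuns [] a b B refl _ _ b<a) rewrite <ᵇ-false⁺ (<⇒≤ b<a) = refl
isBallot-twoRuns (twoRuns (x ∷ A) a b B refl inc₁ inc₂ b<a)
  rewrite length-++ A {[ a ]} | +-comm (length A) 1 = go 0 x A inc₁
  where
  go : ∀ k x A → Increasing (x ∷ A ∷ʳ a) → ballotAux k 0 x (A ++ a ∷ b ∷ B) ≡ true
  go k x []      (x<a ∷ _)   rewrite <ᵇ-true⁺ x<a | <ᵇ-false⁺ (<⇒≤ b<a) =
    ballotAux-increasing (suc k) 1 b B (s≤s z≤n) inc₂
  go k x (y ∷ A) (x<y ∷ inc) rewrite <ᵇ-true⁺ x<y = go (suc k) y A inc

notIn-true⁻ : ∀ x ys → notIn x ys ≡ true → All (x ≢_) ys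
notIn-true⁻ x []       _ = []
notIn-true⁻ x (y ∷ ys) e with x ≡ᵇ y in eq
... | false = ≡ᵇ-false⁻ eq ∷ notIn-true⁻ x ys e

notIn-true⁺ : ∀ {x ys} → All (x ≢_) ys → notIn x ys ≡ true
notIn-true⁺ []           = refl
notIn-true⁺ (x≢y ∷ x∉ys) rewrite ≡ᵇ-false⁺ x≢y = notIn-true⁺ x∉ys

distinct-true⁻ : ∀ xs → distinct xs ≡ true → Unique xs
distinct-true⁻ []       _ = []
distinct-true⁻ (x ∷ xs) e = notIn-true⁻ x xs (∧-trueˡ e) ∷ distinct-true⁻ xs (∧-trueʳ {notIn x xs} e)

distinct-true⁺ : ∀ {xs} → Unique xs → distinct xs ≡ true
distinct-true⁺ []         = refl
distinct-true⁺ (x∉ ∷ u) = ∧-true (notIn-true⁺ x∉) (distinct-true⁺ u)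

valuesOf : ∀ {n k} → Vec (Fin n) k → List ℕ
valuesOf v = map toℕ (toList v)

lookup∈valuesOf : ∀ {n k} (v : Vec (Fin n) k) i → toℕ (lookup v i) ∈ valuesOf v
lookup∈valuesOf (x ∷ v) fzero    = here refl
lookup∈valuesOf (x ∷ v) (fsuc i) = there (lookup∈valuesOf v i)

valuesOf-bounded : ∀ {n k} (v : Vec (Fin n) k) → All (_< n) (valuesOf v)
valuesOf-bounded []      = []
valuesOf-bounded (x ∷ v) = toℕ<n x ∷ valuesOf-bounded v

lookup-injective : ∀ {n k} (v : Vec (Fin n) k) → Unique (valuesOf v) →
                   ∀ i j → lookup v i ≡ lookup v j → i ≡ j
lookup-injective (x ∷ v) u       fzero    fzero    _ = refl
lookup-injective (x ∷ v) (x∉ ∷ _) fzero    (fsuc j) e = ⊥-elim (All.lookup x∉ (lookup∈valuesOf v j) (cong toℕ e))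
lookup-injective (x ∷ v) (x∉ ∷ _) (fsuc i) fzero    e = ⊥-elim (All.lookup x∉ (lookup∈valuesOf v i) (cong toℕ (sym e)))
lookup-injective (x ∷ v) (_ ∷ u) (fsuc i) (fsuc j) e = cong fsuc (lookup-injective v u i j e)

injective⇒surjective : ∀ {n} (f : Fin n → Fin n) → (∀ i j → f i ≡ f j → i ≡ j) → ∀ k → ∃ λ i → f i ≡ k
injective⇒surjective {zero}  f inj ()
injective⇒surjective {suc n} f inj k with any? (λ i → f i Finₚ.≟ k)
... | yes hit = hit
... | no  miss with pigeonhole (n<1+n n) (λ i → punchOut (miss ∘ (i ,_) ∘ sym))
... | i , j , i<j , e =
  ⊥-elim (Finₚ.<⇒≢ i<j (inj i j (punchOut-injective (miss ∘ (i ,_) ∘ sym) (miss ∘ (j ,_) ∘ sym) e)))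

values-complete : ∀ {n} (v : Vec (Fin n) n) → Unique (values v) → ∀ {k} → k < n → k ∈ values v
values-complete v u k<n with injective⇒surjective (lookup v) (lookup-injective v u) (fromℕ< k<n)
... | i , e = subst (_∈ values v) (trans (cong toℕ e) (toℕ-fromℕ< k<n)) (lookup∈valuesOf v i)

members : ∀ {n} → Subset n → List (Fin n)
members {n} s = filterᵇ (lookup s) (allFin n)

nonMembers : ∀ {n} → Subset n → List (Fin n)
nonMembers {n} s = filterᵇ (not ∘ lookup s) (allFin n)

∈-members⁺ : ∀ {n} (s : Subset n) {i} → lookup s i ≡ true → i ∈ members s
∈-members⁺ {n} s {i} e = ∈-filter⁺ _ (∈-allFin i) (≡true⇒T e)

∈-members⁻ : ∀ {n} (s : Subset n) {i} → i ∈ members s → lookup s i ≡ true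
∈-members⁻ {n} s i∈ = T⇒≡true (proj₂ (∈-filter⁻ (T? ∘ lookup s) {xs = allFin n} i∈))

∈-nonMembers⁺ : ∀ {n} (s : Subset n) {i} → lookup s i ≡ false → i ∈ nonMembers s
∈-nonMembers⁺ {n} s {i} e = ∈-filter⁺ _ (∈-allFin i) (≡true⇒T (cong not e))

∈-nonMembers⁻ : ∀ {n} (s : Subset n) {i} → i ∈ nonMembers s → lookup s i ≡ false
∈-nonMembers⁻ {n} s i∈ = not-true (T⇒≡true (proj₂ (∈-filter⁻ (T? ∘ not ∘ lookup s) {xs = allFin n} i∈)))

Sorted : List ℕ → Set
Sorted = AllPairs _<_

allFin-sorted : ∀ n → AllPairs Fin._<_ (allFin n)
allFin-sorted n = AllPairsₚ.tabulate⁺-< id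

sorted-filterᵇ : ∀ {n} (P : Fin n → Bool) → Sorted (map toℕ (filterᵇ P (allFin n)))
sorted-filterᵇ {n} P = AllPairsₚ.map⁺ (AllPairsₚ.filter⁺ _ (allFin-sorted n))

module _ {A : Set} {_≺_ : A → A → Set} (irrefl : Irreflexive _≡_ _≺_) where

  sorted⇒unique : ∀ {xs} → AllPairs _≺_ xs → Unique xs
  sorted⇒unique = AllPairs.map (λ x≺y x≡y → irrefl x≡y x≺y)

module _ {A : Set} {_≺_ : A → A → Set} (irrefl : Irreflexive _≡_ _≺_) (asym : Asymmetric _≺_) where

  sorted-≡ : ∀ {xs ys} → AllPairs _≺_ xs → AllPairs _≺_ ys →
             (∀ {k} → k ∈ xs → k ∈ ys) → (∀ {k} → k ∈ ys → k ∈ xs) → xs ≡ ys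
  sorted-≡ {[]}     {[]}     _ _ _ _ = refl
  sorted-≡ {[]}     {y ∷ ys} _ _ _ ⊇ with () ← ⊇ (here refl)
  sorted-≡ {x ∷ xs} {[]}     _ _ ⊆ _ with () ← ⊆ (here refl)
  sorted-≡ {x ∷ xs} {y ∷ ys} (x≺ ∷ sx) (y≺ ∷ sy) ⊆ ⊇ =
    cong₂ _∷_ x≡y (sorted-≡ sx sy (drop-head x≡y x≺ ⊆) (drop-head (sym x≡y) y≺ ⊇))
    where
    x≡y : x ≡ y
    x≡y with ⊆ (here refl) | ⊇ (here refl)
    ... | here x≡y   | _          = x≡y
    ... | there _    | here y≡x   = sym y≡x
    ... | there x∈ys | there y∈xs = ⊥-elim (asym (All.lookup y≺ x∈ys) (All.lookup x≺ y∈xs))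
    drop-head : ∀ {a b as bs} → a ≡ b → All (a ≺_) as →
                (∀ {k} → k ∈ a ∷ as → k ∈ b ∷ bs) → ∀ {k} → k ∈ as → k ∈ bs
    drop-head a≡b a≺ ⊆′ k∈ with ⊆′ (there k∈)
    ... | here k≡b   = ⊥-elim (irrefl (trans a≡b (sym k≡b)) (All.lookup a≺ k∈))
    ... | there k∈bs = k∈bs

length-filterᵇ-partition : ∀ {A : Set} (P : A → Bool) xs →
  length (filterᵇ P xs) + length (filterᵇ (not ∘ P) xs) ≡ length xs
length-filterᵇ-partition P [] = refl
length-filterᵇ-partition P (x ∷ xs) with P x
... | true  = cong suc (length-filterᵇ-partition P xs)
... | false = trans (+-suc _ _) (cong suc (length-filterᵇ-partition P xs))

length-members-∷ : ∀ {n} b (s : Subset n) →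
  length (filterᵇ (lookup (b ∷ s)) (tabulate fsuc)) ≡ length (members s)
length-members-∷ {n} b s = trans (cong (length ∘ filterᵇ (lookup (b ∷ s))) (sym (map-tabulate {n = n} id fsuc)))
                                 (length-filterᵇ-map (lookup (b ∷ s)) fsuc (allFin n))

size-members : ∀ {n} (s : Subset n) → ∣ s ∣ ≡ length (members s)
size-members []          = refl
size-members (true ∷ s)  = cong suc (trans (size-members s) (sym (length-members-∷ true s)))
size-members (false ∷ s) = trans (size-members s) (sym (length-members-∷ false s))

length-runs : ∀ {n} (s : Subset n) → length (members s ++ nonMembers s) ≡ n
length-runs {n} s = trans (length-++ (members s))
                          (trans (length-filterᵇ-partition (lookup s) (allFin n)) (length-tabulate id))

runsPerm : ∀ {n} → Subset n → Vec (Fin n) n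
runsPerm s = cast (length-runs s) (fromList (members s ++ nonMembers s))

values-runsPerm : ∀ {n} (s : Subset n) → values (runsPerm s) ≡ map toℕ (members s) ++ map toℕ (nonMembers s)
values-runsPerm s = begin
  map toℕ (toList (cast (length-runs s) (fromList (members s ++ nonMembers s))))
    ≡⟨ cong (map toℕ) (toList-cast (length-runs s) _) ⟩
  map toℕ (toList (fromList (members s ++ nonMembers s)))
    ≡⟨ cong (map toℕ) (toList∘fromList _) ⟩
  map toℕ (members s ++ nonMembers s)
    ≡⟨ map-++ toℕ (members s) (nonMembers s) ⟩
  map toℕ (members s) ++ map toℕ (nonMembers s) ∎
  where open ≡-Reasoning

values-injective : ∀ {n} (v w : Vec (Fin n) n) → values v ≡ values w → v ≡ w
values-injective v w e = trans (sym (cast-is-id refl v)) (toList-injective refl v w (map-injective toℕ-injective e))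

NonInitial : ∀ {n} → Subset n → Set
NonInitial {n} s = Σ (Fin n) λ i → Σ (Fin n) λ j → i Fin.< j × lookup s i ≡ false × lookup s j ≡ true

nonEmpty-member : ∀ {n} (s : Subset n) → (∣ s ∣ ≡ᵇ 0) ≡ false → Σ (Fin n) λ j → lookup s j ≡ true
nonEmpty-member (true ∷ s)  _ = fzero , refl
nonEmpty-member (false ∷ s) e with j , s[j] ← nonEmpty-member s e = fsuc j , s[j]

member-nonEmpty : ∀ {n} (s : Subset n) j → lookup s j ≡ true → (∣ s ∣ ≡ᵇ 0) ≡ false
member-nonEmpty (true ∷ s)  _        _ = refl
member-nonEmpty (false ∷ s) (fsuc j) e = member-nonEmpty s j e

isInitial-false⁻ : ∀ {n} (s : Subset n) → isInitial s ≡ false → NonInitial s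
isInitial-false⁻ (true ∷ s) e with i , j , i<j , s[i] , s[j] ← isInitial-false⁻ s e =
  fsuc i , fsuc j , s≤s i<j , s[i] , s[j]
isInitial-false⁻ (false ∷ s) e with j , s[j] ← nonEmpty-member s e =
  fzero , fsuc j , s≤s z≤n , refl , s[j]

isInitial-false⁺ : ∀ {n} (s : Subset n) → NonInitial s → isInitial s ≡ false
isInitial-false⁺ (true ∷ s)  (fsuc i , fsuc j , s≤s i<j , s[i] , s[j]) = isInitial-false⁺ s (i , j , i<j , s[i] , s[j])
isInitial-false⁺ (false ∷ s) (_ , fsuc j , _ , _ , s[j]) = member-nonEmpty s j s[j]

head-≤ : ∀ {x xs k} → Sorted (x ∷ xs) → k ∈ x ∷ xs → x ≤ k
head-≤ _          (here refl) = ≤-refl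
head-≤ (x< ∷ _) (there k∈)  = <⇒≤ (All.lookup x< k∈)

last-≥ : ∀ {xs x k} → Sorted (xs ∷ʳ x) → k ∈ xs ∷ʳ x → k ≤ x
last-≥ {[]}     _          (here refl) = ≤-refl
last-≥ {y ∷ xs} (y< ∷ _) (here refl) = <⇒≤ (All.lookup y< (∈-++⁺ʳ xs (here refl)))
last-≥ {y ∷ xs} (_ ∷ s)  (there k∈)  = last-≥ s k∈

twoRuns-++ : ∀ {A B a b} → Sorted A → Sorted B → a ∈ A → b ∈ B → b < a →
             Σ (TwoRuns (A ++ B)) (λ sp → TwoRuns.firstRun sp ≡ A)
twoRuns-++ {A} {b₀ ∷ B} sA sB a∈A b∈B b<a with initLast A
... | A₀ ∷ʳ′ top =
  twoRuns A₀ top b₀ B (++-assoc A₀ [ top ] (b₀ ∷ B)) (AllPairs⇒Linked sA) (AllPairs⇒Linked sB)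
          (≤-<-trans (head-≤ sB b∈B) (<-≤-trans b<a (last-≥ sA a∈A))) , refl

runsPerm-twoRuns : ∀ {n} (s : Subset n) → NonInitial s →
  Σ (TwoRuns (values (runsPerm s))) (λ sp → TwoRuns.firstRun sp ≡ map toℕ (members s))
runsPerm-twoRuns s (i , j , i<j , s[i] , s[j]) rewrite values-runsPerm s =
  twoRuns-++ (sorted-filterᵇ _) (sorted-filterᵇ _)
             (∈-map⁺ toℕ (∈-members⁺ s s[j])) (∈-map⁺ toℕ (∈-nonMembers⁺ s s[i])) i<j

runs-disjoint : ∀ {n} (s : Subset n) {k} → k ∈ map toℕ (members s) → k ∉ map toℕ (nonMembers s)
runs-disjoint s k∈ k∈′ with ∈-map⁻ toℕ k∈ | ∈-map⁻ toℕ k∈′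
... | i , i∈ , refl | j , j∈ , k≡j with toℕ-injective k≡j
... | refl = true≢false (trans (sym (∈-members⁻ s i∈)) (∈-nonMembers⁻ s j∈))

isPerm-runsPerm : ∀ {n} (s : Subset n) → isPerm (runsPerm s) ≡ true
isPerm-runsPerm s = trans (cong distinct (values-runsPerm s)) (distinct-true⁺
  (Uniqueₚ.++⁺ (sorted⇒unique <-irrefl (sorted-filterᵇ _)) (sorted⇒unique <-irrefl (sorted-filterᵇ _))
              (λ (k∈ , k∈′) → runs-disjoint s k∈ k∈′)))

des-runsPerm : ∀ {n} (s : Subset n) → NonInitial s → des (values (runsPerm s)) ≡ 1
des-runsPerm s ni = des-twoRuns (proj₁ (runsPerm-twoRuns s ni))

isBallot-runsPerm : ∀ {n} (s : Subset n) → NonInitial s → isBallot (values (runsPerm s)) ≡ not (∣ s ∣ ≡ᵇ 1)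
isBallot-runsPerm s ni with sp , firstRun≡ ← runsPerm-twoRuns s ni =
  trans (isBallot-twoRuns sp)
        (cong (λ k → not (k ≡ᵇ 1))
              (trans (cong length firstRun≡) (trans (length-map toℕ (members s)) (sym (size-members s)))))

firstRunSet : ∀ {n} → Vec (Fin n) n → Subset n
firstRunSet v = V.tabulate (λ i → does (toℕ i ∈? leadingRun (values v)))

∈?-members : ∀ {n} (s : Subset n) i → does (toℕ i ∈? map toℕ (members s)) ≡ lookup s i
∈?-members s i with lookup s i in s[i]
... | true  = dec-true (_ ∈? _) (∈-map⁺ toℕ (∈-members⁺ s s[i]))
... | false = dec-false (_ ∈? _) notMember
  where
  notMember : toℕ i ∉ map toℕ (members s)
  notMember i∈ with j , j∈ , i≡j ← ∈-map⁻ toℕ i∈ with refl ← toℕ-injective i≡j =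
    true≢false (trans (sym (∈-members⁻ s j∈)) s[i])

firstRunSet-runsPerm : ∀ {n} (s : Subset n) → NonInitial s → firstRunSet (runsPerm s) ≡ s
firstRunSet-runsPerm s ni with sp , firstRun≡ ← runsPerm-twoRuns s ni =
  trans (tabulate-cong λ i → trans (cong (λ L → does (toℕ i ∈? L)) (trans (leadingRun-twoRuns sp) firstRun≡))
                                   (∈?-members s i))
        (tabulate∘lookup s)

module OneDescentPerm {n} (v : Vec (Fin n) n) (perm : isPerm v ≡ true) (sp : TwoRuns (values v)) where
  open TwoRuns sp

  private
    s = firstRunSet v
    unique : Unique (firstRun ++ secondRun)
    unique = subst Unique shape-runs (distinct-true⁻ (values v) perm)
    bounded : ∀ {k} → k ∈ firstRun ++ secondRun → k < n
    bounded k∈ = All.lookup (valuesOf-bounded v) (subst (_ ∈_) (sym shape-runs) k∈)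
    s[_] : ∀ i → lookup s i ≡ does (toℕ i ∈? firstRun)
    s[ i ] = trans (lookup∘tabulate _ i) (cong (λ L → does (toℕ i ∈? L)) (leadingRun-twoRuns sp))
    ∉secondRun : ∀ {k} → k ∈ firstRun → k ∉ secondRun
    ∉secondRun = go firstRun unique
      where
      go : ∀ xs {ys} → Unique (xs ++ ys) → ∀ {k} → k ∈ xs → k ∉ ys
      go (x ∷ xs) (x∉ ∷ _) (here refl) k∈ = All.lookup (Allₚ.++⁻ʳ xs x∉) k∈ refl
      go (x ∷ xs) (_ ∷ u)  (there k∈)     = go xs u k∈
    fin : ∀ {k} → k < n → Σ (Fin n) (λ i → toℕ i ≡ k)
    fin k<n = fromℕ< k<n , toℕ-fromℕ< k<n
    s[_]-true : ∀ {i} → toℕ i ∈ firstRun → lookup s i ≡ true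
    s[_]-true {i} i∈ = trans s[ i ] (dec-true (_ ∈? _) i∈)
    s[_]-false : ∀ {i} → toℕ i ∉ firstRun → lookup s i ≡ false
    s[_]-false {i} i∉ = trans s[ i ] (dec-false (_ ∈? _) i∉)

  members-firstRunSet : map toℕ (members (firstRunSet v)) ≡ firstRun
  members-firstRunSet = sorted-≡ <-irrefl <-asym (sorted-filterᵇ _) (Linked⇒AllPairs <-trans firstIncreasing) ⊆ ⊇
    where
    ⊆ : ∀ {k} → k ∈ map toℕ (members s) → k ∈ firstRun
    ⊆ k∈ with i , i∈ , refl ← ∈-map⁻ toℕ k∈ with toℕ i ∈? firstRun
    ... | yes i∈′ = i∈′
    ... | no  i∉  = ⊥-elim (true≢false (trans (sym (∈-members⁻ s i∈)) s[ i∉ ]-false))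
    ⊇ : ∀ {k} → k ∈ firstRun → k ∈ map toℕ (members s)
    ⊇ k∈ with i , refl ← fin (bounded (∈-++⁺ˡ k∈)) = ∈-map⁺ toℕ (∈-members⁺ s s[ k∈ ]-true)

  nonMembers-firstRunSet : map toℕ (nonMembers (firstRunSet v)) ≡ secondRun
  nonMembers-firstRunSet = sorted-≡ <-irrefl <-asym (sorted-filterᵇ _) (Linked⇒AllPairs <-trans secondIncreasing) ⊆ ⊇
    where
    ⊆ : ∀ {k} → k ∈ map toℕ (nonMembers s) → k ∈ secondRun
    ⊆ k∈ with i , i∈ , refl ← ∈-map⁻ toℕ k∈
         with ∈-++⁻ firstRun (subst (_ ∈_) shape-runs (values-complete v (distinct-true⁻ (values v) perm) (toℕ<n i)))
    ... | inj₂ i∈₂ = i∈₂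
    ... | inj₁ i∈₁ = ⊥-elim (true≢false (trans (sym s[ i∈₁ ]-true) (∈-nonMembers⁻ s i∈)))
    ⊇ : ∀ {k} → k ∈ secondRun → k ∈ map toℕ (nonMembers s)
    ⊇ k∈ with i , refl ← fin (bounded (∈-++⁺ʳ firstRun k∈)) =
      ∈-map⁺ toℕ (∈-nonMembers⁺ s s[ (λ i∈ → ∉secondRun i∈ k∈) ]-false)

  runsPerm-firstRunSet : runsPerm (firstRunSet v) ≡ v
  runsPerm-firstRunSet = values-injective (runsPerm s) v
    (trans (values-runsPerm s) (trans (cong₂ _++_ members-firstRunSet nonMembers-firstRunSet) (sym shape-runs)))

  isInitial-firstRunSet : isInitial (firstRunSet v) ≡ false
  isInitial-firstRunSet
    with i , refl ← fin (bounded (∈-++⁺ʳ firstRun (here refl)))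
       | j , refl ← fin (bounded (∈-++⁺ˡ {xs = firstRun} (∈-++⁺ʳ front (here refl)))) =
    isInitial-false⁺ s (i , j , valley<peak , s[ (λ i∈ → ∉secondRun i∈ (here refl)) ]-false
                                            , s[ ∈-++⁺ʳ front (here refl) ]-true)

  size-firstRunSet : ∣ firstRunSet v ∣ ≡ length firstRun
  size-firstRunSet = trans (size-members s) (trans (sym (length-map toℕ (members s))) (cong length members-firstRunSet))

OneDescent : ℕ → Set
OneDescent n = Σ (Vec (Fin n) n) (λ v → T (isPerm v ∧ (des (values v) ≡ᵇ 1)))

oneDescent↔nonInitial : ∀ n → OneDescent n ↔ Σ (Subset n) (T ∘ isNonInitial)
oneDescent↔nonInitial n = mk↔ₛ′ to from to∘from from∘to
  where
  twoRunsOf : ∀ v → T (isPerm v ∧ (des (values v) ≡ᵇ 1)) → TwoRuns (values v)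
  twoRunsOf v p = des≡1⇒twoRuns (distinct-true⁻ _ (∧-trueˡ (T⇒≡true p))) (≡ᵇ-true⁻ (∧-trueʳ {isPerm v} (T⇒≡true p)))
  open module Perm v p = OneDescentPerm v (∧-trueˡ (T⇒≡true p)) (twoRunsOf v p)
  nonInitial : ∀ s → T (isNonInitial s) → NonInitial s
  nonInitial s p = isInitial-false⁻ s (not-true (T⇒≡true p))
  to : OneDescent n → Σ (Subset n) (T ∘ isNonInitial)
  to (v , p) = firstRunSet v , ≡true⇒T (cong not (isInitial-firstRunSet v p))
  from : Σ (Subset n) (T ∘ isNonInitial) → OneDescent n
  from (s , p) = runsPerm s , ≡true⇒T (∧-true (isPerm-runsPerm s) (≡ᵇ-true⁺ (des-runsPerm s (nonInitial s p))))
  to∘from : ∀ y → to (from y) ≡ y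
  to∘from (s , p) = subset-≡ {P = isNonInitial} (firstRunSet-runsPerm s (nonInitial s p)) _ p
  from∘to : ∀ x → from (to x) ≡ x
  from∘to (v , p) = subset-≡ {P = λ v → isPerm v ∧ (des (values v) ≡ᵇ 1)} (runsPerm-firstRunSet v p) _ p

∨-false⁻ : ∀ {a b} → a ∨ b ≡ false → a ≡ false × b ≡ false
∨-false⁻ {false} {false} _ = refl , refl

B↔ballotRuns : ∀ n → B n 1 ↔ Σ (Subset n) (T ∘ isBallotRun)
B↔ballotRuns n = mk↔ₛ′ to from to∘from from∘to
  where
  module _ (v : Vec (Fin n) n) (p : T (inB n 1 v)) where
    perm : isPerm v ≡ true
    perm = ∧-trueˡ (T⇒≡true p)
    ballot : isBallot (values v) ≡ true
    ballot = ∧-trueˡ (∧-trueʳ {isPerm v} (T⇒≡true p))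
    twoRunsOf : TwoRuns (values v)
    twoRunsOf = des≡1⇒twoRuns (distinct-true⁻ _ perm)
                              (≡ᵇ-true⁻ (∧-trueʳ {isBallot (values v)} (∧-trueʳ {isPerm v} (T⇒≡true p))))
    open OneDescentPerm v perm twoRunsOf public
    size≢1 : (∣ firstRunSet v ∣ ≡ᵇ 1) ≡ false
    size≢1 = trans (cong (_≡ᵇ 1) (size-firstRunSet))
                   (not-true (trans (sym (isBallot-twoRuns twoRunsOf)) ballot))
  module _ (s : Subset n) (p : T (isBallotRun s)) where
    nonInitial : NonInitial s
    nonInitial = isInitial-false⁻ s (proj₁ (∨-false⁻ (not-true (T⇒≡true p))))
    ballotRun-size≢1 : (∣ s ∣ ≡ᵇ 1) ≡ false
    ballotRun-size≢1 = proj₂ (∨-false⁻ {isInitial s} (not-true (T⇒≡true p)))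
  to : B n 1 → Σ (Subset n) (T ∘ isBallotRun)
  to (v , p) = firstRunSet v , ≡true⇒T (cong not (cong₂ _∨_ (isInitial-firstRunSet v p) (size≢1 v p)))
  from : Σ (Subset n) (T ∘ isBallotRun) → B n 1
  from (s , p) = runsPerm s , ≡true⇒T (∧-true (isPerm-runsPerm s)
    (∧-true (trans (isBallot-runsPerm s (nonInitial s p)) (cong not (ballotRun-size≢1 s p)))
            (≡ᵇ-true⁺ (des-runsPerm s (nonInitial s p)))))
  to∘from : ∀ y → to (from y) ≡ y
  to∘from (s , p) = subset-≡ {P = isBallotRun} (firstRunSet-runsPerm s (nonInitial s p)) _ p
  from∘to : ∀ x → from (to x) ≡ x
  from∘to (v , p) = subset-≡ {P = inB n 1} (runsPerm-firstRunSet v p) _ p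

-- Orbits of a permutation

record IsCycleLength {n} (v : Vec (Fin n) n) (x : Fin n) (K : ℕ) : Set where
  constructor isCycleLength
  field
    positive : 1 ≤ K
    returns  : iter v K x ≡ x
    minimal  : ∀ j → 1 ≤ j → j < K → iter v j x ≢ x

module _ {n} (v : Vec (Fin n) n) where

  iter-+ : ∀ a b x → iter v (a + b) x ≡ iter v a (iter v b x)
  iter-+ zero    b x = refl
  iter-+ (suc a) b x = cong (lookup v) (iter-+ a b x)

  iter-fixed : ∀ {x} → lookup v x ≡ x → ∀ j → iter v j x ≡ x
  iter-fixed fx zero    = refl
  iter-fixed fx (suc j) = trans (cong (lookup v) (iter-fixed fx j)) fx

  iter-* : ∀ {x K} → iter v K x ≡ x → ∀ q → iter v (q * K) x ≡ x
  iter-* e zero    = refl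
  iter-* {x} {K} e (suc q) = trans (iter-+ K (q * K) x) (trans (cong (iter v K) (iter-* e q)) e)

  iter-% : ∀ {x K} .{{_ : NonZero K}} → iter v K x ≡ x → ∀ a → iter v a x ≡ iter v (a % K) x
  iter-% {x} {K} e a = begin
    iter v a x                          ≡⟨ cong (λ k → iter v k x) (m≡m%n+[m/n]*n a K) ⟩
    iter v (a % K + (a / K) * K) x      ≡⟨ iter-+ (a % K) ((a / K) * K) x ⟩
    iter v (a % K) (iter v ((a / K) * K) x) ≡⟨ cong (iter v (a % K)) (iter-* e (a / K)) ⟩
    iter v (a % K) x                    ∎
    where open ≡-Reasoning

  iter-∸ : ∀ {x K} a → a ≤ K → iter v K x ≡ x → iter v (K ∸ a) (iter v a x) ≡ x
  iter-∸ {x} {K} a a≤K e = trans (sym (iter-+ (K ∸ a) a x)) (trans (cong (λ k → iter v k x) (m∸n+n≡m a≤K)) e)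

  isCycleLength-unique : ∀ {x K K′} → IsCycleLength v x K → IsCycleLength v x K′ → K ≡ K′
  isCycleLength-unique {K = K} {K′} (isCycleLength p e m) (isCycleLength p′ e′ m′) with <-cmp K K′
  ... | tri< K<K′ _ _ = ⊥-elim (m′ K p K<K′ e)
  ... | tri≈ _ K≡K′ _ = K≡K′
  ... | tri> _ _ K>K′ = ⊥-elim (m K′ p′ K>K′ e′)

  isCycleLength-fixed : ∀ {x} → lookup v x ≡ x → IsCycleLength v x 1
  isCycleLength-fixed fx = isCycleLength ≤-refl fx (λ j 1≤j j<1 → ⊥-elim (<⇒≱ j<1 1≤j))

  cycLenFrom-isCycleLength : ∀ x fuel k → 1 ≤ k → (∀ j → 1 ≤ j → j < k → iter v j x ≢ x) →
    (Σ ℕ λ K → k ≤ K × K < k + fuel × iter v K x ≡ x) → IsCycleLength v x (cycLenFrom v x k fuel)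
  cycLenFrom-isCycleLength x zero k _ _ (K , k≤K , K<k+0 , _) =
    ⊥-elim (<⇒≱ K<k+0 (subst (_≤ K) (sym (+-identityʳ k)) k≤K))
  cycLenFrom-isCycleLength x (suc fuel) k 1≤k none (K , k≤K , K<k+fuel , e) with iter v k x ≡ᶠ x in eq
  ... | true  = isCycleLength 1≤k (toℕ-injective (≡ᵇ-true⁻ eq)) none
  ... | false = cycLenFrom-isCycleLength x fuel (suc k) (m≤n⇒m≤1+n 1≤k) none′
                  (K , k<K , subst (K <_) (+-suc k fuel) K<k+fuel , e)
    where
    k-misses : iter v k x ≢ x
    k-misses k-hits = ≡ᵇ-false⁻ eq (cong toℕ k-hits)
    none′ : ∀ j → 1 ≤ j → j < suc k → iter v j x ≢ x
    none′ j 1≤j j<1+k with m≤n⇒m<n∨m≡n (s≤s⁻¹ j<1+k)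
    ... | inj₁ j<k  = none j 1≤j j<k
    ... | inj₂ refl = k-misses
    k<K : k < K
    k<K with m≤n⇒m<n∨m≡n k≤K
    ... | inj₁ k<K  = k<K
    ... | inj₂ refl = ⊥-elim (k-misses e)

  module Injective (injective : ∀ x y → lookup v x ≡ lookup v y → x ≡ y) where

    iter-injective : ∀ a x y → iter v a x ≡ iter v a y → x ≡ y
    iter-injective zero    x y e = e
    iter-injective (suc a) x y e = iter-injective a x y (injective _ _ e)

    returns-within : ∀ x → Σ ℕ λ K → 1 ≤ K × K ≤ n × iter v K x ≡ x
    returns-within x with i , j , i<j , e ← pigeonhole (n<1+n n) (λ (j : Fin (suc n)) → iter v (toℕ j) x) =
      toℕ j ∸ toℕ i , m<n⇒0<n∸m i<j , ≤-trans (m∸n≤m (toℕ j) (toℕ i)) (s≤s⁻¹ (toℕ<n j)) ,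
      iter-injective (toℕ i) _ _ (begin
        iter v (toℕ i) (iter v (toℕ j ∸ toℕ i) x) ≡⟨ sym (iter-+ (toℕ i) (toℕ j ∸ toℕ i) x) ⟩
        iter v (toℕ i + (toℕ j ∸ toℕ i)) x         ≡⟨ cong (λ k → iter v k x) (m+[n∸m]≡n (<⇒≤ i<j)) ⟩
        iter v (toℕ j) x                           ≡⟨ sym e ⟩
        iter v (toℕ i) x                           ∎)
      where open ≡-Reasoning

    cycLen-isCycleLength : ∀ x → IsCycleLength v x (cycLen v x)
    cycLen-isCycleLength x with K , 1≤K , K≤n , e ← returns-within x =
      cycLenFrom-isCycleLength x n 1 ≤-refl (λ j 1≤j j<1 → ⊥-elim (<⇒≱ j<1 1≤j)) (K , 1≤K , s≤s K≤n , e)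

    cycLen-unique : ∀ {x K} → IsCycleLength v x K → cycLen v x ≡ K
    cycLen-unique = isCycleLength-unique (cycLen-isCycleLength _)

    isCycleLength-iter : ∀ {x K} a → IsCycleLength v x K → IsCycleLength v (iter v a x) K
    isCycleLength-iter {x} {K} a (isCycleLength p e m) =
      isCycleLength p (trans (iter-swap K a) (cong (iter v a) e))
        (λ j 1≤j j<K ej → m j 1≤j j<K (iter-injective a _ _ (trans (iter-swap a j) ej)))
      where
      iter-swap : ∀ b c → iter v b (iter v c x) ≡ iter v c (iter v b x)
      iter-swap b c = trans (sym (iter-+ b c x)) (trans (cong (λ k → iter v k x) (+-comm b c)) (iter-+ c b x))

    cycLen-iter : ∀ x a → cycLen v (iter v a x) ≡ cycLen v x
    cycLen-iter x a = cycLen-unique (isCycleLength-iter a (cycLen-isCycleLength x))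

    iter-distinct : ∀ {x K} → IsCycleLength v x K → ∀ {a b} → a < b → b < K → iter v a x ≢ iter v b x
    iter-distinct {x} (isCycleLength _ _ m) {a} {b} a<b b<K e =
      m (b ∸ a) (m<n⇒0<n∸m a<b) (≤-<-trans (m∸n≤m b a) b<K)
        (iter-injective a _ _ (trans (sym (iter-+ a (b ∸ a) x))
                                     (trans (cong (λ k → iter v k x) (m+[n∸m]≡n (<⇒≤ a<b))) (sym e))))

countBelow : (ℕ → Bool) → ℕ → ℕ
countBelow p zero    = 0
countBelow p (suc L) = (if p 0 then 1 else 0) + countBelow (p ∘ suc) L

length-filterᵇ-applyUpTo : ∀ (p : ℕ → Bool) f L → length (filterᵇ p (applyUpTo f L)) ≡ countBelow (p ∘ f) L
length-filterᵇ-applyUpTo p f zero = refl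
length-filterᵇ-applyUpTo p f (suc L) with p (f 0)
... | true  = cong suc (length-filterᵇ-applyUpTo p (f ∘ suc) L)
... | false = length-filterᵇ-applyUpTo p (f ∘ suc) L

countBelow-cong : ∀ p q L → (∀ j → j < L → p j ≡ q j) → countBelow p L ≡ countBelow q L
countBelow-cong p q zero    _   = refl
countBelow-cong p q (suc L) p≗q =
  cong₂ _+_ (cong (if_then 1 else 0) (p≗q 0 (s≤s z≤n)))
            (countBelow-cong (p ∘ suc) (q ∘ suc) L (λ j j<L → p≗q (suc j) (s≤s j<L)))

countBelow-complement : ∀ p L → countBelow p L + countBelow (not ∘ p) L ≡ L
countBelow-complement p zero = refl
countBelow-complement p (suc L) with p 0
... | true  = cong suc (countBelow-complement (p ∘ suc) L)
... | false = trans (+-suc _ _) (cong suc (countBelow-complement (p ∘ suc) L))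

countBelow-all : ∀ p L → (∀ j → j < L → p j ≡ true) → countBelow p L ≡ L
countBelow-all p zero    _   = refl
countBelow-all p (suc L) all rewrite all 0 (s≤s z≤n) =
  cong suc (countBelow-all (p ∘ suc) L (λ j j<L → all (suc j) (s≤s j<L)))

countBelow-none : ∀ p L → (∀ j → j < L → p j ≡ false) → countBelow p L ≡ 0
countBelow-none p zero    _    = refl
countBelow-none p (suc L) none rewrite none 0 (s≤s z≤n) =
  countBelow-none (p ∘ suc) L (λ j j<L → none (suc j) (s≤s j<L))

countBelow-snoc : ∀ p L → countBelow p (suc L) ≡ countBelow p L + (if p L then 1 else 0)
countBelow-snoc p zero    = +-comm (if p 0 then 1 else 0) 0
countBelow-snoc p (suc L) =
  trans (cong ((if p 0 then 1 else 0) +_) (countBelow-snoc (p ∘ suc) L))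
        (sym (+-assoc (if p 0 then 1 else 0) (countBelow (p ∘ suc) L) _))

countBelow≡0 : ∀ p L → countBelow p L ≡ 0 → ∀ j → j < L → p j ≡ false
countBelow≡0 p (suc L) e zero    _ with p 0
... | false = refl
countBelow≡0 p (suc L) e (suc j) (s≤s j<L) with p 0
... | false = countBelow≡0 (p ∘ suc) L e j j<L

countBelow≡1 : ∀ p L → countBelow p L ≡ 1 →
  Σ ℕ λ j → j < L × p j ≡ true × (∀ k → k < L → k ≢ j → p k ≡ false)
countBelow≡1 p (suc L) e with p 0 in p0
... | true  = 0 , s≤s z≤n , p0 , others
  where
  others : ∀ k → k < suc L → k ≢ 0 → p k ≡ false
  others zero    _         k≢0 = ⊥-elim (k≢0 refl)
  others (suc k) (s≤s k<L) _   = countBelow≡0 (p ∘ suc) L (suc-injective e) k k<L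
... | false with j , j<L , pj , others ← countBelow≡1 (p ∘ suc) L e = suc j , s≤s j<L , pj , others′
  where
  others′ : ∀ k → k < suc L → k ≢ suc j → p k ≡ false
  others′ zero    _         _   = p0
  others′ (suc k) (s≤s k<L) k≢j = others k k<L (k≢j ∘ cong suc)

allB-applyUpTo⁻ : ∀ (p : ℕ → Bool) f L → allB p (applyUpTo f L) ≡ true → ∀ j → j < L → p (f j) ≡ true
allB-applyUpTo⁻ p f (suc L) e zero    _         = ∧-trueˡ e
allB-applyUpTo⁻ p f (suc L) e (suc j) (s≤s j<L) = allB-applyUpTo⁻ p (f ∘ suc) L (∧-trueʳ {p (f 0)} e) j j<L

allB-applyUpTo⁺ : ∀ (p : ℕ → Bool) f L → (∀ j → j < L → p (f j) ≡ true) → allB p (applyUpTo f L) ≡ true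
allB-applyUpTo⁺ p f zero    _   = refl
allB-applyUpTo⁺ p f (suc L) all =
  ∧-true (all 0 (s≤s z≤n)) (allB-applyUpTo⁺ p (f ∘ suc) L (λ j j<L → all (suc j) (s≤s j<L)))

allB-applyUpTo-false : ∀ (p : ℕ → Bool) f L j → j < L → p (f j) ≡ false → allB p (applyUpTo f L) ≡ false
allB-applyUpTo-false p f L j j<L pj with allB p (applyUpTo f L) in eq
... | true  = ⊥-elim (true≢false (trans (sym (allB-applyUpTo⁻ p f L eq j j<L)) pj))
... | false = refl

allB-tabulate⁻ : ∀ {A : Set} (p : A → Bool) {n} (g : Fin n → A) → allB p (tabulate g) ≡ true → ∀ i → p (g i) ≡ true
allB-tabulate⁻ p g e fzero    = ∧-trueˡ e
allB-tabulate⁻ p g e (fsuc i) = allB-tabulate⁻ p (g ∘ fsuc) (∧-trueʳ {p (g fzero)} e) i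

allB-tabulate⁺ : ∀ {A : Set} (p : A → Bool) {n} (g : Fin n → A) → (∀ i → p (g i) ≡ true) → allB p (tabulate g) ≡ true
allB-tabulate⁺ p {zero}  g _   = refl
allB-tabulate⁺ p {suc n} g all = ∧-true (all fzero) (allB-tabulate⁺ p (g ∘ fsuc) (all ∘ fsuc))

sum-tabulate≡0⁺ : ∀ {n} (h : Fin n → ℕ) → (∀ i → h i ≡ 0) → sum (tabulate h) ≡ 0
sum-tabulate≡0⁺ {zero}  h _    = refl
sum-tabulate≡0⁺ {suc n} h h≡0 = cong₂ _+_ (h≡0 fzero) (sum-tabulate≡0⁺ (h ∘ fsuc) (h≡0 ∘ fsuc))

sum-tabulate≡0⁻ : ∀ {n} (h : Fin n → ℕ) → sum (tabulate h) ≡ 0 → ∀ i → h i ≡ 0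
sum-tabulate≡0⁻ h e fzero    = m+n≡0⇒m≡0 (h fzero) e
sum-tabulate≡0⁻ h e (fsuc i) = sum-tabulate≡0⁻ (h ∘ fsuc) (m+n≡0⇒n≡0 (h fzero) e) i

sum-tabulate≡1⁻ : ∀ {n} (h : Fin n → ℕ) → sum (tabulate h) ≡ 1 →
  Σ (Fin n) λ i₀ → h i₀ ≡ 1 × (∀ i → i ≢ i₀ → h i ≡ 0)
sum-tabulate≡1⁻ {suc n} h e with h fzero in h0
... | zero with i₀ , hi₀ , others ← sum-tabulate≡1⁻ (h ∘ fsuc) e = fsuc i₀ , hi₀ , others′
  where
  others′ : ∀ i → i ≢ fsuc i₀ → h i ≡ 0
  others′ fzero    _   = h0
  others′ (fsuc i) i≢i₀ = others i (i≢i₀ ∘ cong fsuc)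
... | suc zero = fzero , h0 , others
  where
  others : ∀ i → i ≢ fzero → h i ≡ 0
  others fzero    i≢0 = ⊥-elim (i≢0 refl)
  others (fsuc i) _   = sum-tabulate≡0⁻ (h ∘ fsuc) (suc-injective e) i

sum-tabulate-single : ∀ {n} (h : Fin n → ℕ) i₀ → (∀ i → i ≢ i₀ → h i ≡ 0) → sum (tabulate h) ≡ h i₀
sum-tabulate-single h fzero     others =
  trans (cong (h fzero +_) (sum-tabulate≡0⁺ (h ∘ fsuc) (λ i → others (fsuc i) λ ()))) (+-identityʳ (h fzero))
sum-tabulate-single h (fsuc i₀) others =
  cong₂ _+_ (others fzero λ ()) (sum-tabulate-single (h ∘ fsuc) i₀ (λ i i≢i₀ → others (fsuc i) (i≢i₀ ∘ Finₚ.suc-injective)))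

nth : ∀ {A : Set} → A → List A → ℕ → A
nth d []       _       = d
nth d (x ∷ xs) zero    = x
nth d (x ∷ xs) (suc j) = nth d xs j

length-∷ʳ : ∀ {A : Set} (xs : List A) {x} → length (xs ∷ʳ x) ≡ suc (length xs)
length-∷ʳ xs = trans (length-++ xs) (+-comm (length xs) 1)

module _ {A : Set} (d : A) where

  nth∈ : ∀ xs {j} → j < length xs → nth d xs j ∈ xs
  nth∈ (x ∷ xs) {zero}  _         = here refl
  nth∈ (x ∷ xs) {suc j} (s≤s j<) = there (nth∈ xs j<)

  ∈⇒nth : ∀ xs {x} → x ∈ xs → Σ ℕ λ j → j < length xs × nth d xs j ≡ x
  ∈⇒nth (y ∷ xs) (here refl) = 0 , s≤s z≤n , refl
  ∈⇒nth (y ∷ xs) (there x∈) with j , j< , e ← ∈⇒nth xs x∈ = suc j , s≤s j< , e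

  nth-injective : ∀ xs → Unique xs → ∀ {j k} → j < length xs → k < length xs → nth d xs j ≡ nth d xs k → j ≡ k
  nth-injective (x ∷ xs) _        {zero}  {zero}  _         _         _ = refl
  nth-injective (x ∷ xs) (x∉ ∷ _) {zero}  {suc k} _         (s≤s k<) e = ⊥-elim (All.lookup x∉ (nth∈ xs k<) e)
  nth-injective (x ∷ xs) (x∉ ∷ _) {suc j} {zero}  (s≤s j<) _         e = ⊥-elim (All.lookup x∉ (nth∈ xs j<) (sym e))
  nth-injective (x ∷ xs) (_ ∷ u)  {suc j} {suc k} (s≤s j<) (s≤s k<) e = cong suc (nth-injective xs u j< k< e)

  nth-++ˡ : ∀ xs {ys j} → j < length xs → nth d (xs ++ ys) j ≡ nth d xs j
  nth-++ˡ (x ∷ xs) {j = zero}  _         = refl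
  nth-++ˡ (x ∷ xs) {j = suc j} (s≤s j<) = nth-++ˡ xs j<

  nth-∷ʳ-last : ∀ xs {x} → nth d (xs ∷ʳ x) (length xs) ≡ x
  nth-∷ʳ-last []       = refl
  nth-∷ʳ-last (_ ∷ xs) = nth-∷ʳ-last xs

  AllPairs-nth : ∀ {R : A → A → Set} {xs} → AllPairs R xs → ∀ {i j} → i < j → j < length xs → R (nth d xs i) (nth d xs j)
  AllPairs-nth {xs = x ∷ xs} (x~ ∷ _) {zero}  {suc j} _         (s≤s j<) = All.lookup x~ (nth∈ xs j<)
  AllPairs-nth {xs = x ∷ xs} (_ ∷ p)  {suc i} {suc j} (s≤s i<j) (s≤s j<) = AllPairs-nth p i<j j<

  unique-rotate : ∀ {x : A} {xs} → Unique (x ∷ xs) → Unique (xs ∷ʳ x)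
  unique-rotate {x} {xs} (x∉ ∷ u) =
    Uniqueₚ.++⁺ u ([] ∷ []) (λ { (y∈ , here y≡x) → All.lookup x∉ y∈ (sym y≡x) })

  AllPairs-reverse : ∀ {R : A → A → Set} {xs} → AllPairs R xs → AllPairs (flip R) (reverse xs)
  AllPairs-reverse {xs = []}     [] = []
  AllPairs-reverse {xs = x ∷ xs} (x~ ∷ p) rewrite unfold-reverse x xs =
    AllPairsₚ.++⁺ (AllPairs-reverse p) ([] ∷ [])
                 (All.tabulate λ y∈ → All.lookup x~ (Anyₚ.reverse⁻ y∈) ∷ [])

≡ᶠ-true⁺ : ∀ {n} {x y : Fin n} → x ≡ y → (x ≡ᶠ y) ≡ true
≡ᶠ-true⁺ x≡y = ≡ᵇ-true⁺ (cong toℕ x≡y)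

≡ᶠ-false⁺ : ∀ {n} {x y : Fin n} → x ≢ y → (x ≡ᶠ y) ≡ false
≡ᶠ-false⁺ x≢y = ≡ᵇ-false⁺ (x≢y ∘ toℕ-injective)

_∈?ᶠ_ : ∀ {n} (x : Fin n) xs → Dec (x ∈ xs)
x ∈?ᶠ xs = Any.any? (x Finₚ.≟_) xs

toList-tabulate : ∀ {A : Set} {m} (f : Fin m → A) → V.toList (V.tabulate f) ≡ tabulate f
toList-tabulate {m = zero}  f = refl
toList-tabulate {m = suc m} f = cong (f fzero ∷_) (toList-tabulate (f ∘ fsuc))

if-false : ∀ {A : Set} {b} {x y : A} → b ≡ false → (if b then x else y) ≡ y
if-false refl = refl

module _ {n : ℕ} where

  cycleStep : Fin n → List (Fin n) → Fin n → Fin n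
  cycleStep c₀ []           x = x
  cycleStep c₀ (c ∷ [])     x = if x ≡ᶠ c then c₀ else x
  cycleStep c₀ (c ∷ c′ ∷ r) x = if x ≡ᶠ c then c′ else cycleStep c₀ (c′ ∷ r) x

  cycleFun : List (Fin n) → Fin n → Fin n
  cycleFun []       x = x
  cycleFun (c₀ ∷ r) x = cycleStep c₀ (c₀ ∷ r) x

  cyclePerm : List (Fin n) → Vec (Fin n) n
  cyclePerm C = V.tabulate (cycleFun C)

  cycleStep-∉ : ∀ c₀ D {x} → x ∉ D → cycleStep c₀ D x ≡ x
  cycleStep-∉ c₀ []           _   = refl
  cycleStep-∉ c₀ (c ∷ [])     x∉ rewrite ≡ᶠ-false⁺ (x∉ ∘ here) = refl
  cycleStep-∉ c₀ (c ∷ c′ ∷ r) x∉ =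
    trans (if-false (≡ᶠ-false⁺ (x∉ ∘ here))) (cycleStep-∉ c₀ (c′ ∷ r) (x∉ ∘ there))

  cycleStep-nth : ∀ c₀ d ds → Unique (d ∷ ds) → ∀ {j} → j < length (d ∷ ds) →
                  cycleStep c₀ (d ∷ ds) (nth c₀ (d ∷ ds) j) ≡ nth c₀ (ds ∷ʳ c₀) j
  cycleStep-nth c₀ d []        _        {zero}  _ rewrite ≡ᶠ-true⁺ (refl {x = d}) = refl
  cycleStep-nth c₀ d (d′ ∷ ds) _        {zero}  _ rewrite ≡ᶠ-true⁺ (refl {x = d}) = refl
  cycleStep-nth c₀ d []        _        {suc j} (s≤s ())
  cycleStep-nth c₀ d (d′ ∷ ds) (d∉ ∷ u) {suc j} (s≤s j<) =
    trans (if-false (≡ᶠ-false⁺ (λ e → All.lookup d∉ (nth∈ c₀ (d′ ∷ ds) j<) (sym e))))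
          (cycleStep-nth c₀ d′ ds u j<)

  module CyclePerm (c₀ : Fin n) (r : List (Fin n)) (unique : Unique (c₀ ∷ r)) where

    C : List (Fin n)
    C = c₀ ∷ r

    L : ℕ
    L = length C

    σ : Vec (Fin n) n
    σ = cyclePerm C

    c : ℕ → Fin n
    c = nth c₀ C

    σ-nth : ∀ {j} → j < L → lookup σ (c j) ≡ nth c₀ (r ∷ʳ c₀) j
    σ-nth j<L = trans (lookup∘tabulate (cycleFun C) _) (cycleStep-nth c₀ c₀ r unique j<L)

    σ-∉ : ∀ {x} → x ∉ C → lookup σ x ≡ x
    σ-∉ x∉ = trans (lookup∘tabulate (cycleFun C) _) (cycleStep-∉ c₀ C x∉)

    rotated⊆C : ∀ {x} → x ∈ r ∷ʳ c₀ → x ∈ C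
    rotated⊆C x∈ with ∈-++⁻ r x∈
    ... | inj₁ x∈r        = there x∈r
    ... | inj₂ (here x≡c₀) = here x≡c₀

    <L⇒<rotated : ∀ {j} → j < L → j < length (r ∷ʳ c₀)
    <L⇒<rotated = subst (_ <_) (sym (length-∷ʳ r))

    iter-σ : ∀ {j} → j < L → iter σ j c₀ ≡ c j
    iter-σ {zero}  _       = refl
    iter-σ {suc j} (s≤s j<) = begin
      lookup σ (iter σ j c₀)      ≡⟨ cong (lookup σ) (iter-σ (<-trans (n<1+n j) (s≤s j<))) ⟩
      lookup σ (c j)              ≡⟨ σ-nth (<-trans (n<1+n j) (s≤s j<)) ⟩
      nth c₀ (r ∷ʳ c₀) j          ≡⟨ nth-++ˡ c₀ r j< ⟩
      c (suc j)                   ∎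
      where open ≡-Reasoning

    σ-at-last : lookup σ (c (length r)) ≡ c₀
    σ-at-last = trans (σ-nth (n<1+n (length r))) (nth-∷ʳ-last c₀ r)

    σ-last : ∀ {r′ z} → r ≡ r′ ∷ʳ z → lookup σ z ≡ c₀
    σ-last {r′} {z} r≡ = trans (cong (lookup σ) (sym c-last)) σ-at-last
      where
      c-last : c (length r) ≡ z
      c-last = begin
        nth c₀ (c₀ ∷ r) (length r)               ≡⟨ cong (λ xs → nth c₀ (c₀ ∷ xs) (length xs)) r≡ ⟩
        nth c₀ (c₀ ∷ r′ ∷ʳ z) (length (r′ ∷ʳ z)) ≡⟨ cong (nth c₀ (c₀ ∷ r′ ∷ʳ z)) (length-∷ʳ r′) ⟩
        nth c₀ (r′ ∷ʳ z) (length r′)             ≡⟨ nth-∷ʳ-last c₀ r′ ⟩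
        z                                        ∎
        where open ≡-Reasoning

    iter-σ-L : iter σ L c₀ ≡ c₀
    iter-σ-L = trans (cong (lookup σ) (iter-σ (n<1+n (length r)))) σ-at-last

    σ-injective : ∀ x y → lookup σ x ≡ lookup σ y → x ≡ y
    σ-injective x y e with x ∈?ᶠ C | y ∈?ᶠ C
    ... | yes x∈ | yes y∈ with j , j< , refl ← ∈⇒nth c₀ C x∈ | k , k< , refl ← ∈⇒nth c₀ C y∈ =
      cong c (nth-injective c₀ (r ∷ʳ c₀) (unique-rotate c₀ unique) (<L⇒<rotated j<) (<L⇒<rotated k<)
               (trans (sym (σ-nth j<)) (trans e (σ-nth k<))))
    ... | yes x∈ | no y∉ with j , j< , refl ← ∈⇒nth c₀ C x∈ =
      ⊥-elim (y∉ (subst (_∈ C) (trans (sym (σ-nth j<)) (trans e (σ-∉ y∉)))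
                        (rotated⊆C (nth∈ c₀ (r ∷ʳ c₀) (<L⇒<rotated j<)))))
    ... | no x∉ | yes y∈ with k , k< , refl ← ∈⇒nth c₀ C y∈ =
      ⊥-elim (x∉ (subst (_∈ C) (trans (sym (σ-nth k<)) (trans (sym e) (σ-∉ x∉)))
                        (rotated⊆C (nth∈ c₀ (r ∷ʳ c₀) (<L⇒<rotated k<)))))
    ... | no x∉ | no y∉ = trans (sym (σ-∉ x∉)) (trans e (σ-∉ y∉))

    open Injective σ σ-injective

    isCycleLength-c₀ : IsCycleLength σ c₀ L
    isCycleLength-c₀ = isCycleLength (s≤s z≤n) iter-σ-L returns-late
      where
      returns-late : ∀ j → 1 ≤ j → j < L → iter σ j c₀ ≢ c₀
      returns-late j 1≤j j<L e =
        <⇒≢ 1≤j (sym (nth-injective c₀ C unique j<L (s≤s z≤n) (trans (sym (iter-σ j<L)) e)))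

    cycLen-c₀ : cycLen σ c₀ ≡ L
    cycLen-c₀ = cycLen-unique isCycleLength-c₀

    ∈⇒orbit : ∀ {x} → x ∈ C → Σ ℕ λ k → k < L × iter σ k c₀ ≡ x
    ∈⇒orbit x∈ with k , k< , e ← ∈⇒nth c₀ C x∈ = k , k< , trans (iter-σ k<) e

    cycLen-∈ : ∀ {x} → x ∈ C → cycLen σ x ≡ L
    cycLen-∈ x∈ with k , _ , refl ← ∈⇒orbit x∈ = trans (cycLen-iter c₀ k) cycLen-c₀

    cycLen-∉ : ∀ {x} → x ∉ C → cycLen σ x ≡ 1
    cycLen-∉ x∉ = cycLen-unique (isCycleLength-fixed σ (σ-∉ x∉))

    σ-moves : 2 ≤ L → ∀ {x} → x ∈ C → lookup σ x ≢ x
    σ-moves 2≤L x∈ with k , _ , refl ← ∈⇒orbit x∈ =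
      IsCycleLength.minimal (isCycleLength-iter k isCycleLength-c₀) 1 ≤-refl 2≤L

    isPerm-σ : isPerm σ ≡ true
    isPerm-σ = distinct-true⁺ (subst Unique (sym (cong (map toℕ) (toList-tabulate (cycleFun C))))
      (Uniqueₚ.map⁺ toℕ-injective (Uniqueₚ.tabulate⁺ (σ-injective′ _ _))))
      where
      σ-injective′ : ∀ x y → cycleFun C x ≡ cycleFun C y → x ≡ y
      σ-injective′ x y e =
        σ-injective x y (trans (lookup∘tabulate (cycleFun C) x) (trans e (sym (lookup∘tabulate (cycleFun C) y))))

module _ {n} (v : Vec (Fin n) n) where

  ascent descent : Fin n → ℕ → Bool
  ascent  x j = toℕ (iter v j x) ≤ᵇ toℕ (iter v (suc j) x)
  descent x j = toℕ (iter v (suc j) x) <ᵇ toℕ (iter v j x)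

  cA-countBelow : ∀ x → cA v x ≡ countBelow (ascent x) (cycLen v x)
  cA-countBelow x = length-filterᵇ-applyUpTo _ id (cycLen v x)

  cD-countBelow : ∀ x → cD v x ≡ countBelow (descent x) (cycLen v x)
  cD-countBelow x = length-filterᵇ-applyUpTo _ id (cycLen v x)

  cA+cD : ∀ x → cA v x + cD v x ≡ cycLen v x
  cA+cD x = trans (cong₂ _+_ (cA-countBelow x) (trans (cD-countBelow x)
                    (countBelow-cong _ _ (cycLen v x) (λ j _ → <ᵇ≡not-≤ᵇ (toℕ (iter v j x)) (toℕ (iter v (suc j) x))))))
                  (countBelow-complement (ascent x) (cycLen v x))

  cD-fixed : (∀ x y → lookup v x ≡ lookup v y → x ≡ y) → ∀ {x} → lookup v x ≡ x → cD v x ≡ 0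
  cD-fixed injective {x} fixed = begin
    cD v x                                                ≡⟨ cD-countBelow x ⟩
    countBelow (descent x) (cycLen v x)                   ≡⟨ cong (countBelow (descent x)) (cycLen-unique (isCycleLength-fixed v fixed)) ⟩
    (if toℕ (lookup v x) <ᵇ toℕ x then 1 else 0) + 0    ≡⟨ cong (λ y → (if toℕ y <ᵇ toℕ x then 1 else 0) + 0) fixed ⟩
    (if toℕ x <ᵇ toℕ x then 1 else 0) + 0                ≡⟨ cong (λ b → (if b then 1 else 0) + 0) (<ᵇ-false⁺ (≤-refl {toℕ x})) ⟩
    0                                                     ∎
    where
    open ≡-Reasoning
    open Injective v injective

  cycleContribution : Fin n → ℕ
  cycleContribution i = if isCycleMin v i then cA v i ⊓ cD v i else 0

  Mstat-tabulate : Mstat v ≡ sum (tabulate cycleContribution)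
  Mstat-tabulate = cong sum (map-tabulate id cycleContribution)

  Mstat-single : ∀ i₀ → (∀ i → i ≢ i₀ → cycleContribution i ≡ 0) → Mstat v ≡ cycleContribution i₀
  Mstat-single i₀ others = trans Mstat-tabulate (sum-tabulate-single cycleContribution i₀ others)

module MinHeadCycle {n} (c₀ : Fin n) (r : List (Fin n)) (unique : Unique (c₀ ∷ r))
                    (head-min : ∀ {j} → 0 < j → j < suc (length r) → toℕ c₀ < toℕ (nth c₀ (c₀ ∷ r) j)) where

  open CyclePerm c₀ r unique
  open Injective σ σ-injective

  iter-σ-min : ∀ {j} → 0 < j → j < L → toℕ c₀ < toℕ (iter σ j c₀)
  iter-σ-min 0<j j<L = subst (λ x → toℕ c₀ < toℕ x) (sym (iter-σ j<L)) (head-min 0<j j<L)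

  isCycleMin-c₀ : isCycleMin σ c₀ ≡ true
  isCycleMin-c₀ = allB-applyUpTo⁺ _ id (cycLen σ c₀) c₀≤
    where
    c₀≤ : ∀ j → j < cycLen σ c₀ → (toℕ c₀ ≤ᵇ toℕ (iter σ j c₀)) ≡ true
    c₀≤ zero    _   = ≤ᵇ-true⁺ (≤-refl {toℕ c₀})
    c₀≤ (suc j) j<  = ≤ᵇ-true⁺ (<⇒≤ (iter-σ-min (s≤s z≤n) (subst (suc j <_) cycLen-c₀ j<)))

  isCycleMin-other : ∀ {x} → x ∈ C → x ≢ c₀ → isCycleMin σ x ≡ false
  isCycleMin-other x∈ x≢c₀ with ∈⇒orbit x∈
  ... | zero  , _ , x≡c₀ = ⊥-elim (x≢c₀ (sym x≡c₀))
  ... | suc k , k< , refl =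
    allB-applyUpTo-false _ id (cycLen σ (iter σ (suc k) c₀)) (L ∸ suc k)
      (subst (L ∸ suc k <_) (sym (cycLen-∈ x∈)) (s≤s (m∸n≤m (length r) k)))
      (≤ᵇ-false⁺ (subst (λ y → toℕ y < toℕ (iter σ (suc k) c₀)) (sym (iter-∸ σ (suc k) (<⇒≤ k<) iter-σ-L))
                         (iter-σ-min (s≤s z≤n) k<)))

  cD-∉ : ∀ {x} → x ∉ C → cD σ x ≡ 0
  cD-∉ x∉ = cD-fixed σ σ-injective (σ-∉ x∉)

  contribution-other : ∀ i → i ≢ c₀ → cycleContribution σ i ≡ 0
  contribution-other i i≢c₀ with i ∈?ᶠ C
  ... | yes i∈ rewrite isCycleMin-other i∈ i≢c₀ = refl
  ... | no  i∉ rewrite cD-∉ i∉ | ⊓-zeroʳ (cA σ i) with isCycleMin σ i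
  ...   | true  = refl
  ...   | false = refl

  Mstat-σ : Mstat σ ≡ cA σ c₀ ⊓ cD σ c₀
  Mstat-σ = trans (Mstat-single σ c₀ contribution-other) (cong (if_then cA σ c₀ ⊓ cD σ c₀ else 0) isCycleMin-c₀)

  oddOrder-σ : odd L ≡ true → oddOrder σ ≡ true
  oddOrder-σ odd-L = allB-tabulate⁺ (odd ∘ cycLen σ) id odd-cycLen
    where
    odd-cycLen : ∀ i → odd (cycLen σ i) ≡ true
    odd-cycLen i with i ∈?ᶠ C
    ... | yes i∈ rewrite cycLen-∈ i∈ = odd-L
    ... | no  i∉ rewrite cycLen-∉ i∉ = refl

  inP-σ : odd L ≡ true → cA σ c₀ ⊓ cD σ c₀ ≡ 1 → inP n 1 σ ≡ true
  inP-σ odd-L M≡1 = ∧-true isPerm-σ (∧-true (oddOrder-σ odd-L) (≡ᵇ-true⁺ (trans Mstat-σ M≡1)))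

  ascent-σ : ∀ {j} → suc j < L → ascent σ c₀ j ≡ (toℕ (c j) ≤ᵇ toℕ (c (suc j)))
  ascent-σ {j} j+1<L = cong₂ (λ x y → toℕ x ≤ᵇ toℕ y) (iter-σ (<-trans (n<1+n j) j+1<L)) (iter-σ j+1<L)

  ascent-last : 2 ≤ L → ascent σ c₀ (length r) ≡ false
  ascent-last 2≤L = ≤ᵇ-false⁺ (subst (λ y → toℕ y < toℕ (iter σ (length r) c₀)) (sym iter-σ-L)
                                     (iter-σ-min (s≤s⁻¹ 2≤L) (n<1+n (length r))))

  cA+cD-σ : cA σ c₀ + cD σ c₀ ≡ L
  cA+cD-σ = trans (cA+cD σ c₀) cycLen-c₀

  cA-σ : cA σ c₀ ≡ countBelow (ascent σ c₀) L
  cA-σ = trans (cA-countBelow σ c₀) (cong (countBelow _) cycLen-c₀)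

  increasing⇒M≡1 : 2 ≤ L → (∀ {j} → suc j < L → toℕ (c j) < toℕ (c (suc j))) → cA σ c₀ ⊓ cD σ c₀ ≡ 1
  increasing⇒M≡1 2≤L increasing = trans (cong₂ _⊓_ cA≡ cD≡1) (m≥n⇒m⊓n≡n (s≤s⁻¹ 2≤L))
    where
    cA≡ : cA σ c₀ ≡ length r
    cA≡ = begin
      cA σ c₀                                                  ≡⟨ cA-σ ⟩
      countBelow (ascent σ c₀) L                               ≡⟨ countBelow-snoc (ascent σ c₀) (length r) ⟩
      countBelow (ascent σ c₀) (length r) + (if ascent σ c₀ (length r) then 1 else 0)
        ≡⟨ cong₂ _+_ (countBelow-all _ _ (λ j j< → trans (ascent-σ (s≤s j<)) (≤ᵇ-true⁺ (<⇒≤ (increasing (s≤s j<))))))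
                     (cong (if_then 1 else 0) (ascent-last 2≤L)) ⟩
      length r + 0                                             ≡⟨ +-identityʳ (length r) ⟩
      length r                                                 ∎
      where open ≡-Reasoning
    cD≡1 : cD σ c₀ ≡ 1
    cD≡1 = +-cancelˡ-≡ (length r) _ _ (trans (cong (_+ cD σ c₀) (sym cA≡)) (trans cA+cD-σ (+-comm 1 (length r))))

  decreasing⇒M≡1 : 2 ≤ L → (∀ {j} → suc (suc j) < L → toℕ (c (suc (suc j))) < toℕ (c (suc j))) →
                   cA σ c₀ ⊓ cD σ c₀ ≡ 1
  decreasing⇒M≡1 2≤L decreasing = trans (cong₂ _⊓_ cA≡1 cD≡) (m≤n⇒m⊓n≡m (s≤s⁻¹ 2≤L))
    where
    descends : ∀ j → j < length r → ascent σ c₀ (suc j) ≡ false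
    descends j j< with m≤n⇒m<n∨m≡n j<
    ... | inj₁ j+1<  = trans (ascent-σ (s≤s j+1<)) (≤ᵇ-false⁺ (decreasing (s≤s j+1<)))
    ... | inj₂ j+1≡ = subst (λ k → ascent σ c₀ k ≡ false) (sym j+1≡) (ascent-last 2≤L)
    cA≡1 : cA σ c₀ ≡ 1
    cA≡1 = trans cA-σ (cong₂ _+_ (cong (if_then 1 else 0) (trans (ascent-σ 2≤L) (≤ᵇ-true⁺ (<⇒≤ (head-min (s≤s z≤n) 2≤L)))))
                                 (countBelow-none _ (length r) descends))
    cD≡ : cD σ c₀ ≡ length r
    cD≡ = +-cancelˡ-≡ 1 _ _ (trans (cong (_+ cD σ c₀) (sym cA≡1)) cA+cD-σ)

support : ∀ {n} → Vec (Fin n) n → Subset n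
support v = V.tabulate (λ x → not (lookup v x ≡ᶠ x))

downward : ∀ {A : Set} → List A → List A
downward []       = []
downward (e ∷ es) = e ∷ reverse es

cycleOn : ∀ {n} → Bool → Subset n → Vec (Fin n) n
cycleOn true  s = cyclePerm (members s)
cycleOn false s = cyclePerm (downward (members s))

-- The increasing cycle on the support sends its second smallest point up, the other shape sends it to the smallest.
directionOf : ∀ {n} → Vec (Fin n) n → List (Fin n) → Bool
directionOf v (e₀ ∷ e₁ ∷ _) = not (lookup v e₁ ≡ᶠ e₀)
directionOf v _             = true

direction : ∀ {n} → Vec (Fin n) n → Bool
direction v = directionOf v (members (support v))

support-cyclePerm : ∀ {n} (s : Subset n) c₀ r (u : Unique (c₀ ∷ r)) → 2 ≤ suc (length r) →
  (∀ {x} → x ∈ c₀ ∷ r → lookup s x ≡ true) → (∀ {x} → lookup s x ≡ true → x ∈ c₀ ∷ r) →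
  support (cyclePerm (c₀ ∷ r)) ≡ s
support-cyclePerm s c₀ r u 2≤L ∈⇒s s⇒∈ = trans (tabulate-cong moved≡s) (tabulate∘lookup s)
  where
  open CyclePerm c₀ r u
  moved≡s : ∀ x → not (lookup σ x ≡ᶠ x) ≡ lookup s x
  moved≡s x with x ∈?ᶠ C
  ... | yes x∈ rewrite ≡ᶠ-false⁺ (σ-moves 2≤L x∈) | ∈⇒s x∈ = refl
  ... | no  x∉ rewrite ≡ᶠ-true⁺ (σ-∉ x∉) with lookup s x in s[x]
  ...   | true  = ⊥-elim (x∉ (s⇒∈ s[x]))
  ...   | false = refl

members-sorted : ∀ {n} (s : Subset n) → AllPairs Fin._<_ (members s)
members-sorted {n} s = AllPairsₚ.filter⁺ _ (allFin-sorted n)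

record OddCycleShape {n} (s : Subset n) : Set where
  constructor oddCycleShape
  field
    e₀ e₁ e₂ : Fin n
    rest     : List (Fin n)
    members≡ : members s ≡ e₀ ∷ e₁ ∷ e₂ ∷ rest
    odd-size : odd (length (e₀ ∷ e₁ ∷ e₂ ∷ rest)) ≡ true

oddCycleShape-of : ∀ {n} (s : Subset n) → T (isOddCycleSupport s) → OddCycleShape s
oddCycleShape-of s p = shape (members s) refl (subst (λ k → odd k ≡ true) (size-members s) odd-size)
                                              (subst (λ k → (k ≡ᵇ 1) ≡ false) (size-members s) size≢1)
  where
  odd-size : odd ∣ s ∣ ≡ true
  odd-size = ∧-trueˡ (T⇒≡true p)
  size≢1 : (∣ s ∣ ≡ᵇ 1) ≡ false
  size≢1 = not-true (∧-trueʳ {odd ∣ s ∣} (T⇒≡true p))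
  shape : ∀ xs → members s ≡ xs → odd (length xs) ≡ true → (length xs ≡ᵇ 1) ≡ false → OddCycleShape s
  shape (e₀ ∷ e₁ ∷ e₂ ∷ rest) eq odd _ = oddCycleShape e₀ e₁ e₂ rest eq odd

CycleOnSpec : ∀ {n} → Bool → Subset n → Set
CycleOnSpec {n} d s = inP n 1 (cycleOn d s) ≡ true × support (cycleOn d s) ≡ s × direction (cycleOn d s) ≡ d

cycleOnSpec-via : ∀ {n} d (s : Subset n) C → cycleOn d s ≡ cyclePerm C →
  inP n 1 (cyclePerm C) ≡ true → support (cyclePerm C) ≡ s → directionOf (cyclePerm C) (members s) ≡ d →
  CycleOnSpec d s
cycleOnSpec-via {n} d s C cycleOn≡ inP-C support-C direction-C =
  subst (λ σ → inP n 1 σ ≡ true × support σ ≡ s × direction σ ≡ d) (sym cycleOn≡)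
        (inP-C , support-C , trans (cong (directionOf (cyclePerm C) ∘ members) support-C) direction-C)

cycleOn-up : ∀ {n} (s : Subset n) → T (isOddCycleSupport s) → CycleOnSpec true s
cycleOn-up s p with oddCycleShape e₀ e₁ e₂ rest members≡ odd-L ← oddCycleShape-of s p =
  cycleOnSpec-via true s (e₀ ∷ r) (cong cyclePerm members≡)
    (inP-σ odd-L (increasing⇒M≡1 (s≤s (s≤s z≤n)) (λ {j} j+1< → AllPairs-nth e₀ sorted (n<1+n j) j+1<)))
    (support-cyclePerm s e₀ r unique (s≤s (s≤s z≤n))
       (λ x∈ → ∈-members⁻ s (subst (_ ∈_) (sym members≡) x∈)) (λ s[x] → subst (_ ∈_) members≡ (∈-members⁺ s s[x])))
    (trans (cong (λ xs → directionOf σ xs) members≡)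
           (cong not (trans (cong (_≡ᶠ e₀) (σ-nth {1} (s≤s (s≤s z≤n))))
                            (≡ᶠ-false⁺ (λ e₂≡e₀ → <-irrefl (cong toℕ (sym e₂≡e₀))
                                                     (AllPairs-nth e₀ sorted {0} {2} (s≤s z≤n) (s≤s (s≤s (s≤s z≤n)))))))))
  where
  r = e₁ ∷ e₂ ∷ rest
  sorted : AllPairs Fin._<_ (e₀ ∷ r)
  sorted = subst (AllPairs Fin._<_) members≡ (members-sorted s)
  unique : Unique (e₀ ∷ r)
  unique = sorted⇒unique Finₚ.<-irrefl sorted
  open MinHeadCycle e₀ r unique (λ 0<j j<L → AllPairs-nth e₀ sorted 0<j j<L)
  open CyclePerm e₀ r unique using (σ; σ-nth)

cycleOn-down : ∀ {n} (s : Subset n) → T (isOddCycleSupport s) → CycleOnSpec false s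
cycleOn-down s p with oddCycleShape e₀ e₁ e₂ rest members≡ odd-L ← oddCycleShape-of s p =
  cycleOnSpec-via false s (e₀ ∷ D) (cong (cyclePerm ∘ downward) members≡)
    (inP-σ (subst (λ k → odd (suc k) ≡ true) (sym (length-reverse upper)) odd-L)
           (decreasing⇒M≡1 2≤L (λ {j} j+2< → AllPairs-nth e₀ D-sorted (n<1+n j) (s≤s⁻¹ j+2<))))
    (support-cyclePerm s e₀ D unique 2≤L
       (λ x∈ → ∈-members⁻ s (subst (_ ∈_) (sym members≡) (∈C⇒∈members x∈)))
       (λ s[x] → ∈members⇒∈C (subst (_ ∈_) members≡ (∈-members⁺ s s[x]))))
    (trans (cong (λ xs → directionOf σ xs) members≡)
           (cong not (trans (cong (_≡ᶠ e₀) (σ-last (unfold-reverse e₁ (e₂ ∷ rest)))) (≡ᶠ-true⁺ (refl {x = e₀})))))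
  where
  upper = e₁ ∷ e₂ ∷ rest
  D = reverse upper
  sorted : AllPairs Fin._<_ (e₀ ∷ upper)
  sorted = subst (AllPairs Fin._<_) members≡ (members-sorted s)
  D-sorted : AllPairs (flip Fin._<_) D
  D-sorted with _ ∷ upper-sorted ← sorted = AllPairs-reverse e₀ upper-sorted
  e₀<D : ∀ {x} → x ∈ D → toℕ e₀ < toℕ x
  e₀<D x∈ with e₀<upper ∷ _ ← sorted = All.lookup e₀<upper (Anyₚ.reverse⁻ x∈)
  unique : Unique (e₀ ∷ D)
  unique = All.tabulate (λ x∈ e₀≡x → <-irrefl (cong toℕ e₀≡x) (e₀<D x∈))
         ∷ sorted⇒unique (λ x≡y → Finₚ.<-irrefl (sym x≡y)) D-sorted
  2≤L : 2 ≤ suc (length D)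
  2≤L = s≤s (subst (1 ≤_) (sym (length-reverse upper)) (s≤s z≤n))
  ∈C⇒∈members : ∀ {x} → x ∈ e₀ ∷ D → x ∈ e₀ ∷ upper
  ∈C⇒∈members (here x≡e₀) = here x≡e₀
  ∈C⇒∈members (there x∈)  = there (Anyₚ.reverse⁻ x∈)
  ∈members⇒∈C : ∀ {x} → x ∈ e₀ ∷ upper → x ∈ e₀ ∷ D
  ∈members⇒∈C (here x≡e₀) = here x≡e₀
  ∈members⇒∈C (there x∈)  = there (Anyₚ.reverse⁺ x∈)
  head-min : ∀ {j} → 0 < j → j < suc (length D) → toℕ e₀ < toℕ (nth e₀ (e₀ ∷ D) j)
  head-min {suc j} _ (s≤s j<) = e₀<D (nth∈ e₀ D j<)
  open MinHeadCycle e₀ D unique head-min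
  open CyclePerm e₀ D unique using (σ; σ-last)

cycleOn-spec : ∀ {n} d (s : Subset n) → T (isOddCycleSupport s) → CycleOnSpec d s
cycleOn-spec true  = cycleOn-up
cycleOn-spec false = cycleOn-down

-- Permutations of odd order with M = 1

nondecreasing : ∀ (f : ℕ → ℕ) K → (∀ j → j < K → f j ≤ f (suc j)) → ∀ {a b} → a ≤ b → b ≤ K → f a ≤ f b
nondecreasing f K step {b = zero}  z≤n _ = ≤-refl
nondecreasing f K step {a} {suc b} a≤b+1 b+1≤K with m≤n⇒m<n∨m≡n a≤b+1
... | inj₁ a<b+1 = ≤-trans (nondecreasing f K step (s≤s⁻¹ a<b+1) (<⇒≤ b+1≤K)) (step b b+1≤K)
... | inj₂ refl  = ≤-refl

strictly-decreasing : ∀ (f : ℕ → ℕ) K → (∀ j → j < K → f (suc j) < f j) → ∀ b → b ≤ K → f b + b ≤ f 0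
strictly-decreasing f K step zero    _     = ≤-reflexive (+-identityʳ (f 0))
strictly-decreasing f K step (suc b) b+1≤K = begin
  f (suc b) + suc b ≡⟨ +-suc (f (suc b)) b ⟩
  suc (f (suc b)) + b ≤⟨ +-monoˡ-≤ b (step b b+1≤K) ⟩
  f b + b           ≤⟨ strictly-decreasing f K step b (<⇒≤ b+1≤K) ⟩
  f 0               ∎
  where open ≤-Reasoning

argmin : ∀ (f : ℕ → ℕ) K → 0 < K → Σ ℕ λ m → m < K × (∀ j → j < K → f m ≤ f j)
argmin f (suc zero)    _ = 0 , s≤s z≤n , λ { zero _ → ≤-refl ; (suc j) (s≤s ()) }
argmin f (suc (suc K)) _ with m , m< , min ← argmin f (suc K) (s≤s z≤n) | ≤-total (f m) (f (suc K))
... | inj₁ fm≤ = m , m≤n⇒m≤1+n m< , λ j j< → case-last j j< (min j) fm≤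
  where
  case-last : ∀ j → j < suc (suc K) → (j < suc K → f m ≤ f j) → f m ≤ f (suc K) → f m ≤ f j
  case-last j j< below last with m≤n⇒m<n∨m≡n (s≤s⁻¹ j<)
  ... | inj₁ j<K+1 = below j<K+1
  ... | inj₂ refl  = last
... | inj₂ fK≤ = suc K , ≤-refl , λ j j< → case-last j j<
  where
  case-last : ∀ j → j < suc (suc K) → f (suc K) ≤ f j
  case-last j j< with m≤n⇒m<n∨m≡n (s≤s⁻¹ j<)
  ... | inj₁ j<K+1 = ≤-trans fK≤ (min j j<K+1)
  ... | inj₂ refl  = ≤-refl

⊓≡1 : ∀ m k → m ⊓ k ≡ 1 → m ≡ 1 ⊎ k ≡ 1
⊓≡1 m k e with ⊓-sel m k
... | inj₁ m⊓k≡m = inj₁ (trans (sym m⊓k≡m) e)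
... | inj₂ m⊓k≡k = inj₂ (trans (sym m⊓k≡k) e)

⊓≡0 : ∀ m k → m ⊓ k ≡ 0 → m ≡ 0 ⊎ k ≡ 0
⊓≡0 m k e with ⊓-sel m k
... | inj₁ m⊓k≡m = inj₁ (trans (sym m⊓k≡m) e)
... | inj₂ m⊓k≡k = inj₂ (trans (sym m⊓k≡k) e)

module _ {n} (v : Vec (Fin n) n) (injective : ∀ x y → lookup v x ≡ lookup v y → x ≡ y) where
  open Injective v injective

  -- Around a cycle the values return to their start, so they can only rise or only fall on a fixed point.
  M≡0⇒fixed : ∀ x → cA v x ⊓ cD v x ≡ 0 → lookup v x ≡ x
  M≡0⇒fixed x M≡0 with ⊓≡0 (cA v x) (cD v x) M≡0
  ... | inj₂ cD≡0 = toℕ-injective (≤-antisym f1≤f0 (rises 0 positive))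
    where
    open IsCycleLength (cycLen-isCycleLength x)
    K = cycLen v x
    f : ℕ → ℕ
    f j = toℕ (iter v j x)
    rises : ∀ j → j < K → f j ≤ f (suc j)
    rises j j<K = <ᵇ-false⁻ (countBelow≡0 (descent v x) K (trans (sym (cD-countBelow v x)) cD≡0) j j<K)
    f1≤f0 : f 1 ≤ f 0
    f1≤f0 = subst (λ y → f 1 ≤ toℕ y) returns (nondecreasing f K rises positive ≤-refl)
  ... | inj₁ cA≡0 = ⊥-elim (<⇒≱ positive (+-cancelˡ-≤ (f 0) K 0
          (≤-trans (subst (λ y → toℕ y + K ≤ f 0) returns (strictly-decreasing f K falls K ≤-refl))
                   (≤-reflexive (sym (+-identityʳ (f 0)))))))
    where
    open IsCycleLength (cycLen-isCycleLength x)
    K = cycLen v x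
    f : ℕ → ℕ
    f j = toℕ (iter v j x)
    falls : ∀ j → j < K → f (suc j) < f j
    falls j j<K = ≤ᵇ-false⁻ (countBelow≡0 (ascent v x) K (trans (sym (cA-countBelow v x)) cA≡0) j j<K)

nth-applyUpTo : ∀ {A : Set} (d : A) g K {j} → j < K → nth d (applyUpTo g K) j ≡ g j
nth-applyUpTo d g (suc K) {zero}  _         = refl
nth-applyUpTo d g (suc K) {suc j} (s≤s j<K) = nth-applyUpTo d (g ∘ suc) K j<K

orbit : ∀ {n} → Vec (Fin n) n → Fin n → ℕ → List (Fin n)
orbit v x K = applyUpTo (λ j → iter v j x) K

module _ {n} (v : Vec (Fin n) n) (injective : ∀ x y → lookup v x ≡ lookup v y → x ≡ y) where
  open Injective v injective

  orbit-unique : ∀ {x K} → IsCycleLength v x K → Unique (orbit v x K)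
  orbit-unique {K = K} cl = AllPairsₚ.applyUpTo⁺₁ _ K (λ i<j j<K → iter-distinct cl i<j j<K)

  cyclePerm-orbit : ∀ {x K} (cl : IsCycleLength v x (suc K)) →
    (∀ {y} → y ∉ orbit v x (suc K) → lookup v y ≡ y) → v ≡ cyclePerm (orbit v x (suc K))
  cyclePerm-orbit {x} {K} cl outside-fixed =
    trans (sym (tabulate∘lookup v)) (tabulate-cong λ y → trans (agree y) (lookup∘tabulate (cycleFun C) y))
    where
    open CyclePerm x (applyUpTo (λ j → iter v (suc j) x) K) (orbit-unique cl)
    L≡ : L ≡ suc K
    L≡ = cong suc (length-applyUpTo _ K)
    c≡ : ∀ {j} → j < L → c j ≡ iter v j x
    c≡ {j} j<L = nth-applyUpTo x (λ j → iter v j x) (suc K) (subst (j <_) L≡ j<L)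
    iter-σ≡iter-v : ∀ {j} → j ≤ L → iter σ j x ≡ iter v j x
    iter-σ≡iter-v j≤L with m≤n⇒m<n∨m≡n j≤L
    ... | inj₁ j<L  = trans (iter-σ j<L) (c≡ j<L)
    ... | inj₂ refl = trans iter-σ-L (sym (subst (λ k → iter v k x ≡ x) (sym L≡) (IsCycleLength.returns cl)))
    agree : ∀ y → lookup v y ≡ lookup σ y
    agree y with y ∈?ᶠ C
    ... | no  y∉ = trans (outside-fixed y∉) (sym (σ-∉ y∉))
    ... | yes y∈ with j , j<L , refl ← ∈⇒nth x C y∈ = begin
      lookup v (c j)               ≡⟨ cong (lookup v) (c≡ j<L) ⟩
      iter v (suc j) x             ≡⟨ sym (iter-σ≡iter-v j<L) ⟩
      lookup σ (iter σ j x)        ≡⟨ cong (lookup σ) (iter-σ j<L) ⟩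
      lookup σ (c j)               ∎
      where open ≡-Reasoning

linked-applyUpTo : ∀ {A : Set} {R : A → A → Set} (g : ℕ → A) K →
  (∀ {j} → suc j < K → R (g j) (g (suc j))) → Linked R (applyUpTo g K)
linked-applyUpTo g zero          _    = []
linked-applyUpTo g (suc zero)    _    = [-]
linked-applyUpTo g (suc (suc K)) step = step (s≤s (s≤s z≤n)) ∷ linked-applyUpTo (g ∘ suc) (suc K) (step ∘ s≤s)

isOddCycleSupport-size : ∀ {n} (s : Subset n) {K} → ∣ s ∣ ≡ suc K → odd (suc K) ≡ true → 2 ≤ suc K →
                         T (isOddCycleSupport s)
isOddCycleSupport-size s {zero}  _     _        (s≤s ())
isOddCycleSupport-size s {suc K} size≡ odd-size _ =
  ≡true⇒T (subst (λ k → odd k ∧ not (k ≡ᵇ 1) ≡ true) (sym size≡) (∧-true odd-size refl))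

module ElementOfP {n} (v : Vec (Fin n) n) (inP-v : inP n 1 v ≡ true) where

  perm : isPerm v ≡ true
  perm = ∧-trueˡ inP-v

  injective : ∀ x y → lookup v x ≡ lookup v y → x ≡ y
  injective = lookup-injective v (distinct-true⁻ _ perm)

  open Injective v injective

  private
    M≡1 : Mstat v ≡ 1
    M≡1 = ≡ᵇ-true⁻ (∧-trueʳ {oddOrder v} (∧-trueʳ {isPerm v} inP-v))
    unique-contribution = sum-tabulate≡1⁻ (cycleContribution v) (trans (sym (Mstat-tabulate v)) M≡1)

  i₀ : Fin n
  i₀ = proj₁ unique-contribution

  contribution-i₀ : cycleContribution v i₀ ≡ 1
  contribution-i₀ = proj₁ (proj₂ unique-contribution)

  contribution-other : ∀ i → i ≢ i₀ → cycleContribution v i ≡ 0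
  contribution-other = proj₂ (proj₂ unique-contribution)

  isCycleMin-i₀ : isCycleMin v i₀ ≡ true
  isCycleMin-i₀ with isCycleMin v i₀ in eq
  ... | true  = refl
  ... | false = ⊥-elim (0≢1+n (trans (sym (cong (if_then cA v i₀ ⊓ cD v i₀ else 0) eq)) contribution-i₀))

  M-i₀ : cA v i₀ ⊓ cD v i₀ ≡ 1
  M-i₀ = trans (sym (cong (if_then cA v i₀ ⊓ cD v i₀ else 0) isCycleMin-i₀)) contribution-i₀

  L₀ : ℕ
  L₀ = cycLen v i₀

  cl₀ : IsCycleLength v i₀ L₀
  cl₀ = cycLen-isCycleLength i₀

  -- Every moved point x lies on the cycle of i₀: the minimum of x's cycle contributes, so it must be i₀.
  moved⇒onCycle : ∀ {x} → lookup v x ≢ x → Σ ℕ λ k → k < L₀ × iter v k i₀ ≡ x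
  moved⇒onCycle {x} moved
    with m , m<K , min ← argmin (λ j → toℕ (iter v j x)) (cycLen v x)
                                 (IsCycleLength.positive (cycLen-isCycleLength x)) =
    k , k<L₀ , iter-k
    where
    open IsCycleLength (cycLen-isCycleLength x)
    K = cycLen v x
    instance
      K≢0 : NonZero K
      K≢0 = >-nonZero positive
      L₀≢0 : NonZero L₀
      L₀≢0 = >-nonZero (IsCycleLength.positive cl₀)
    y = iter v m x
    back : iter v (K ∸ m) y ≡ x
    back = iter-∸ v m (<⇒≤ m<K) returns
    isCycleMin-y : isCycleMin v y ≡ true
    isCycleMin-y = allB-applyUpTo⁺ _ id (cycLen v y) λ j _ →
      ≤ᵇ-true⁺ (subst (λ z → toℕ y ≤ toℕ z) (sym (trans (sym (iter-+ v j m x)) (iter-% v returns (j + m))))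
                      (min ((j + m) % K) (m%n<n (j + m) K)))
    y≡i₀ : y ≡ i₀
    y≡i₀ with y Finₚ.≟ i₀
    ... | yes y≡i₀ = y≡i₀
    ... | no  y≢i₀ = ⊥-elim (moved (trans (cong (lookup v) x≡y) (trans y-fixed (sym x≡y))))
      where
      y-fixed : lookup v y ≡ y
      y-fixed = M≡0⇒fixed v injective y
        (trans (sym (cong (if_then cA v y ⊓ cD v y else 0) isCycleMin-y)) (contribution-other y y≢i₀))
      x≡y : x ≡ y
      x≡y = trans (sym back) (iter-fixed v y-fixed (K ∸ m))
    k = (K ∸ m) % L₀
    k<L₀ = m%n<n (K ∸ m) L₀
    iter-k : iter v k i₀ ≡ x
    iter-k = trans (sym (iter-% v (IsCycleLength.returns cl₀) (K ∸ m))) (trans (cong (iter v (K ∸ m)) (sym y≡i₀)) back)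

  i₀-below : ∀ {j} → 0 < j → j < L₀ → toℕ i₀ < toℕ (iter v j i₀)
  i₀-below 0<j j<L₀ = ≤∧≢⇒< (≤ᵇ-true⁻ (allB-applyUpTo⁻ _ id L₀ isCycleMin-i₀ _ j<L₀))
                            (λ e → iter-distinct cl₀ 0<j j<L₀ (toℕ-injective e))

  2≤L₀ : 2 ≤ L₀
  2≤L₀ with m≤n⇒m<n∨m≡n (IsCycleLength.positive cl₀)
  ... | inj₁ 1<L₀ = 1<L₀
  ... | inj₂ 1≡L₀ = ⊥-elim (0≢1+n (trans (sym (trans (cong (cA v i₀ ⊓_) cD≡0) (⊓-zeroʳ (cA v i₀)))) M-i₀))
    where
    cD≡0 : cD v i₀ ≡ 0
    cD≡0 = cD-fixed v injective (subst (λ k → iter v k i₀ ≡ i₀) (sym 1≡L₀) (IsCycleLength.returns cl₀))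

  odd-L₀ : odd L₀ ≡ true
  odd-L₀ = allB-tabulate⁻ (odd ∘ cycLen v) id (∧-trueˡ (∧-trueʳ {isPerm v} inP-v)) i₀

  orbit-moves : ∀ {j} → j < L₀ → lookup v (iter v j i₀) ≢ iter v j i₀
  orbit-moves {j} _ = IsCycleLength.minimal (isCycleLength-iter j cl₀) 1 ≤-refl 2≤L₀

  support[_] : ∀ x → lookup (support v) x ≡ not (lookup v x ≡ᶠ x)
  support[ x ] = lookup∘tabulate _ x

  support⇒moved : ∀ {x} → lookup (support v) x ≡ true → lookup v x ≢ x
  support⇒moved {x} s[x] fixed = true≢false (trans (sym s[x]) (trans support[ x ] (cong not (≡ᶠ-true⁺ fixed))))

  members-support⇒orbit : ∀ {x} → x ∈ members (support v) → x ∈ orbit v i₀ L₀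
  members-support⇒orbit x∈ =
    let k , k< , e = moved⇒onCycle (support⇒moved (∈-members⁻ (support v) x∈))
    in subst (_∈ orbit v i₀ L₀) e (∈-applyUpTo⁺ (λ j → iter v j i₀) k<)

  orbit⇒members-support : ∀ {x} → x ∈ orbit v i₀ L₀ → x ∈ members (support v)
  orbit⇒members-support x∈ =
    let k , k< , x≡ = ∈-applyUpTo⁻ (λ j → iter v j i₀) x∈
    in ∈-members⁺ (support v)
         (trans support[ _ ] (cong not (≡ᶠ-false⁺ (subst (λ y → lookup v y ≢ y) (sym x≡) (orbit-moves k<)))))

  outside-orbit-fixed : ∀ {y} → y ∉ orbit v i₀ L₀ → lookup v y ≡ y
  outside-orbit-fixed {y} y∉ with lookup v y Finₚ.≟ y
  ... | yes fixed = fixed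
  ... | no  moved =
    ⊥-elim (y∉ (members-support⇒orbit (∈-members⁺ (support v) (trans support[ y ] (cong not (≡ᶠ-false⁺ moved))))))

  module OnCycle (K : ℕ) (L₀≡ : L₀ ≡ suc K) where

    c : ℕ → Fin n
    c j = iter v j i₀

    r : List (Fin n)
    r = applyUpTo (c ∘ suc) K

    cl : IsCycleLength v i₀ (suc K)
    cl = subst (IsCycleLength v i₀) L₀≡ cl₀

    <L₀ : ∀ {j} → j < suc K → j < L₀
    <L₀ {j} = subst (j <_) (sym L₀≡)

    members⇒cycle : ∀ {x} → x ∈ members (support v) → x ∈ i₀ ∷ r
    members⇒cycle x∈ = subst (_ ∈_) (cong (orbit v i₀) L₀≡) (members-support⇒orbit x∈)

    cycle⇒members : ∀ {x} → x ∈ i₀ ∷ r → x ∈ members (support v)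
    cycle⇒members x∈ = orbit⇒members-support (subst (_ ∈_) (cong (orbit v i₀) (sym L₀≡)) x∈)

    v≡cycle : v ≡ cyclePerm (i₀ ∷ r)
    v≡cycle = cyclePerm-orbit v injective cl (λ y∉ → outside-orbit-fixed (y∉ ∘ subst (_ ∈_) (cong (orbit v i₀) L₀≡)))

    -- Leaving i₀ is an ascent and returning to it is a descent, so a single descent is the last step
    -- and a single ascent the first.
    descent⇒last : cD v i₀ ≡ 1 → members (support v) ≡ i₀ ∷ r
    descent⇒last cD≡1 = sorted-≡ Finₚ.<-irrefl Finₚ.<-asym (members-sorted (support v))
                                 (Linked⇒AllPairs Finₚ.<-trans (linked-applyUpTo c (suc K) rises))
                                 members⇒cycle cycle⇒members
      where
      one = countBelow≡1 (descent v i₀) L₀ (trans (sym (cD-countBelow v i₀)) cD≡1)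
      j* = proj₁ one
      others = proj₂ (proj₂ (proj₂ one))
      last-descends : descent v i₀ K ≡ true
      last-descends = <ᵇ-true⁺ (subst (λ y → toℕ y < toℕ (c K)) (sym (IsCycleLength.returns cl))
                                      (i₀-below (s≤s⁻¹ (subst (2 ≤_) L₀≡ 2≤L₀)) (<L₀ ≤-refl)))
      K≡j* : K ≡ j*
      K≡j* with K ≟ j*
      ... | yes K≡j* = K≡j*
      ... | no  K≢j* = ⊥-elim (true≢false (trans (sym last-descends) (others K (<L₀ ≤-refl) K≢j*)))
      rises : ∀ {j} → suc j < suc K → toℕ (c j) < toℕ (c (suc j))
      rises {j} (s≤s j<K) =
        ≤∧≢⇒< (<ᵇ-false⁻ (others j (<L₀ (m≤n⇒m≤1+n j<K)) (λ j≡j* → <-irrefl (trans j≡j* (sym K≡j*)) j<K)))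
              (λ e → iter-distinct cl (n<1+n j) (s≤s j<K) (toℕ-injective e))

    ascent⇒first : cA v i₀ ≡ 1 → members (support v) ≡ i₀ ∷ reverse r
    ascent⇒first cA≡1 = sorted-≡ Finₚ.<-irrefl Finₚ.<-asym (members-sorted (support v))
                                 (All.tabulate i₀<reversed ∷ AllPairs-reverse i₀ r-decreasing)
                                 (∈reversed ∘ members⇒cycle) (cycle⇒members ∘ ∈unreversed)
      where
      one = countBelow≡1 (ascent v i₀) L₀ (trans (sym (cA-countBelow v i₀)) cA≡1)
      j* = proj₁ one
      others = proj₂ (proj₂ (proj₂ one))
      first-ascends : ascent v i₀ 0 ≡ true
      first-ascends = ≤ᵇ-true⁺ (<⇒≤ (i₀-below (s≤s z≤n) 2≤L₀))
      0≡j* : 0 ≡ j*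
      0≡j* with 0 ≟ j*
      ... | yes 0≡j* = 0≡j*
      ... | no  0≢j* = ⊥-elim (true≢false (trans (sym first-ascends) (others 0 (<L₀ (s≤s z≤n)) 0≢j*)))
      falls : ∀ {j} → suc j < K → toℕ (c (suc (suc j))) < toℕ (c (suc j))
      falls {j} j+1<K = ≤ᵇ-false⁻ (others (suc j) (<L₀ (<-trans j+1<K (n<1+n K))) (λ e → 0≢1+n (trans 0≡j* (sym e))))
      r-decreasing : AllPairs (flip Fin._<_) r
      r-decreasing = Linked⇒AllPairs (flip Finₚ.<-trans) (linked-applyUpTo (c ∘ suc) K falls)
      i₀<reversed : ∀ {x} → x ∈ reverse r → toℕ i₀ < toℕ x
      i₀<reversed x∈ =
        let k , k< , x≡ = ∈-applyUpTo⁻ (c ∘ suc) (Anyₚ.reverse⁻ x∈)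
        in subst (λ y → toℕ i₀ < toℕ y) (sym x≡) (i₀-below (s≤s z≤n) (<L₀ (s≤s k<)))
      ∈reversed : ∀ {x} → x ∈ i₀ ∷ r → x ∈ i₀ ∷ reverse r
      ∈reversed (here x≡i₀) = here x≡i₀
      ∈reversed (there x∈)  = there (Anyₚ.reverse⁺ x∈)
      ∈unreversed : ∀ {x} → x ∈ i₀ ∷ reverse r → x ∈ i₀ ∷ r
      ∈unreversed (here x≡i₀) = here x≡i₀
      ∈unreversed (there x∈)  = there (Anyₚ.reverse⁻ x∈)

    oddCycleSupport : ∀ {xs} → members (support v) ≡ i₀ ∷ xs → length xs ≡ K → T (isOddCycleSupport (support v))
    oddCycleSupport {xs} members≡ length≡ =
      isOddCycleSupport-size (support v) size≡ (subst (λ k → odd k ≡ true) L₀≡ odd-L₀) (subst (2 ≤_) L₀≡ 2≤L₀)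
      where
      size≡ : ∣ support v ∣ ≡ suc K
      size≡ = begin
        ∣ support v ∣                 ≡⟨ size-members (support v) ⟩
        length (members (support v)) ≡⟨ cong length members≡ ⟩
        suc (length xs)              ≡⟨ cong suc length≡ ⟩
        suc K                        ∎
        where open ≡-Reasoning

    result : T (isOddCycleSupport (support v)) × Σ Bool (λ d → cycleOn d (support v) ≡ v)
    result with ⊓≡1 (cA v i₀) (cD v i₀) M-i₀
    ... | inj₂ cD≡1 = oddCycleSupport (descent⇒last cD≡1) (length-applyUpTo _ K) , true ,
                      trans (cong cyclePerm (descent⇒last cD≡1)) (sym v≡cycle)
    ... | inj₁ cA≡1 = oddCycleSupport (ascent⇒first cA≡1) (trans (length-reverse r) (length-applyUpTo _ K)) , false ,
                      trans (cong (cyclePerm ∘ downward) (ascent⇒first cA≡1))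
                            (trans (cong (cyclePerm ∘ (i₀ ∷_)) (reverse-involutive r)) (sym v≡cycle))

  result : T (isOddCycleSupport (support v)) × Σ Bool (λ d → cycleOn d (support v) ≡ v)
  result = OnCycle.result (L₀ ∸ 1) (sym (trans (+-comm 1 (L₀ ∸ 1)) (m∸n+n≡m (IsCycleLength.positive cl₀))))

P↔directedOddSupports : ∀ n → P n 1 ↔ (Bool × Σ (Subset n) (T ∘ isOddCycleSupport))
P↔directedOddSupports n = mk↔ₛ′ to from to∘from from∘to
  where
  to : P n 1 → Bool × Σ (Subset n) (T ∘ isOddCycleSupport)
  to (v , p) = direction v , support v , proj₁ (ElementOfP.result v (T⇒≡true p))
  from : Bool × Σ (Subset n) (T ∘ isOddCycleSupport) → P n 1
  from (d , s , q) = cycleOn d s , ≡true⇒T (proj₁ (cycleOn-spec d s q))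
  to∘from : ∀ y → to (from y) ≡ y
  to∘from (d , s , q) = cong₂ _,_ (proj₂ (proj₂ spec)) (subset-≡ {P = isOddCycleSupport} (proj₁ (proj₂ spec)) _ q)
    where spec = cycleOn-spec d s q
  from∘to : ∀ x → from (to x) ≡ x
  from∘to (v , p) =
    subset-≡ {P = inP n 1} (trans (cong (λ d′ → cycleOn d′ (support v)) direction≡) cycleOn≡v) _ p
    where
    result = ElementOfP.result v (T⇒≡true p)
    d = proj₁ (proj₂ result)
    cycleOn≡v : cycleOn d (support v) ≡ v
    cycleOn≡v = proj₂ (proj₂ result)
    direction≡ : direction v ≡ d
    direction≡ = trans (cong direction (sym cycleOn≡v)) (proj₂ (proj₂ (cycleOn-spec d (support v) (proj₁ result))))

subset-counts : ∀ m {cB cP cE} → cB + (suc m + suc m) ≡ 2 ^ suc m → cP + suc m ≡ 2 ^ m → cE + suc m ≡ 2 ^ m →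
                cB ≡ cP + cP × cP + cP ≡ 2 * cE
subset-counts m {cB} {cP} {cE} countB countP countE =
  cB≡ , trans (cong (λ c → c + c) cP≡cE) (cong (cE +_) (sym (+-identityʳ cE)))
  where
  open ≡-Reasoning
  cP≡cE : cP ≡ cE
  cP≡cE = +-cancelʳ-≡ (suc m) cP cE (trans countP (sym countE))
  rearrange : ∀ c k → (c + k) + ((c + k) + 0) ≡ (c + c) + (k + k)
  rearrange = solve-∀
  cB≡ : cB ≡ cP + cP
  cB≡ = +-cancelʳ-≡ (suc m + suc m) cB (cP + cP) (begin
    cB + (suc m + suc m)              ≡⟨ countB ⟩
    2 ^ m + (2 ^ m + 0)               ≡⟨ cong (λ x → x + (x + 0)) (sym countP) ⟩
    (cP + suc m) + ((cP + suc m) + 0) ≡⟨ rearrange cP (suc m) ⟩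
    (cP + cP) + (suc m + suc m)       ∎)

b≡countBallotRuns : ∀ n → b n 1 ≡ countSubsets n isBallotRun
b≡countBallotRuns n = ↔⇒≡ (begin
  Fin (b n 1)                       ↔⟨ ↔-sym (count-↔ (inB n 1)) ⟩
  B n 1                             ↔⟨ B↔ballotRuns n ⟩
  Σ (Subset n) (T ∘ isBallotRun)    ↔⟨ countSubsets-↔ n isBallotRun ⟩
  Fin (countSubsets n isBallotRun)  ∎)
  where open Related.EquationalReasoning

p≡2·countOddCycleSupports : ∀ n → p n 1 ≡ countSubsets n isOddCycleSupport + countSubsets n isOddCycleSupport
p≡2·countOddCycleSupports n = ↔⇒≡ (begin
  Fin (p n 1)                                   ↔⟨ ↔-sym (count-↔ (inP n 1)) ⟩
  P n 1                                         ↔⟨ P↔directedOddSupports n ⟩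
  (Bool × Σ (Subset n) (T ∘ isOddCycleSupport)) ↔⟨ Σ-Bool ⟩
  (Σ (Subset n) (T ∘ isOddCycleSupport) ⊎ Σ (Subset n) (T ∘ isOddCycleSupport))
                                                ↔⟨ countSubsets-↔ n _ ⊎-↔ countSubsets-↔ n _ ⟩
  (Fin (countSubsets n isOddCycleSupport) ⊎ Fin (countSubsets n isOddCycleSupport))
                                                ↔⟨ ↔-sym +↔⊎ ⟩
  Fin (countSubsets n isOddCycleSupport + countSubsets n isOddCycleSupport) ∎)
  where open Related.EquationalReasoning

E≡countNonInitial : ∀ n → E n 1 ≡ countSubsets n isNonInitial
E≡countNonInitial n = ↔⇒≡ (begin
  Fin (E n 1)                        ↔⟨ ↔-sym (count-↔ _) ⟩
  OneDescent n                       ↔⟨ oneDescent↔nonInitial n ⟩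
  Σ (Subset n) (T ∘ isNonInitial)    ↔⟨ countSubsets-↔ n isNonInitial ⟩
  Fin (countSubsets n isNonInitial)  ∎)
  where open Related.EquationalReasoning

theorem1p3 : (n : ℕ) → 1 ≤ n →
    (b n 1 ≡ p n 1 × p n 1 ≡ 2 * E (n ∸ 1) 1) × (B n 1 ↔ P n 1)
theorem1p3 (suc m) _ = (b≡p , p≡2E) , B↔P
  where
  counts = subset-counts m (countSubsets-isBallotRun m) (countSubsets-isOddCycleSupport m)
                           (countSubsets-isNonInitial m)
  b≡p : b (suc m) 1 ≡ p (suc m) 1
  b≡p = trans (b≡countBallotRuns (suc m)) (trans (proj₁ counts) (sym (p≡2·countOddCycleSupports (suc m))))
  p≡2E : p (suc m) 1 ≡ 2 * E m 1
  p≡2E = trans (p≡2·countOddCycleSupports (suc m)) (trans (proj₂ counts) (cong (2 *_) (sym (E≡countNonInitial m))))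
  B↔P : B (suc m) 1 ↔ P (suc m) 1
  B↔P = begin
    B (suc m) 1       ↔⟨ count-↔ (inB (suc m) 1) ⟩
    Fin (b (suc m) 1) ≡⟨ cong Fin b≡p ⟩
    Fin (p (suc m) 1) ↔⟨ ↔-sym (count-↔ (inP (suc m) 1)) ⟩
    P (suc m) 1       ∎
    where open Related.EquationalReasoning
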